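{- For every $m\in\mathbb Z$, \[ \langle\mathrm{vac}|\,e^{ -\theta^*}\,\phi^{[\beta]*}_m\,\phi^{(\beta)}_0\,e^{\theta^*}\,|\mathrm{vac}\rangle=\delta_{m,0}. \]
   Context: $\mathcal C$ is the associative $\mathbb Q(\beta)$-algebra generated by $\phi_n$ ($n\in\mathbb Z$) with $\phi_m\phi_n+\phi_n\phi_m=2(-1)^m\delta_{m+n,0}$; $|\mathrm{vac}\rangle$ satisfies $\phi_n|\mathrm{vac}\rangle=0$ for $n<0$, $\langle\mathrm{vac}|\phi_n=0$ for $n>0$, $\langle\mathrm{vac}|\mathrm{vac}\rangle=1$, $\langle ua|v\rangle=\langle u|av\rangle$. $a\mapsto a^*$ is the anti-automorphism with $\phi_n^*=(-1)^n\phi_{ -n}$. Deformed fermions: $\sum_{n\ge0}\phi^{(\beta)}_nz^n=\sum_{n\ge0}\phi_n(z+\beta/2)^n$, $\sum_{n\ge1}\phi^{(\beta)}_{ -n}z^{ -n}=\sum_{n\ge1}\phi_{ -n}\big(\frac{z^{ -1}}{1+\frac\beta2z^{ -1}}\big)^n$, $\sum_{n\ge1}\phi^{[\beta]}_nz^n=\sum_{n\ge1}\phi_n\big(\frac{z}{1+\frac\beta2z}\big)^n$, $\sum_{n\ge0}\phi^{[\beta]}_{ -n}z^{ -n}=\sum_{n\ge0}\phi_{ -n}(z^{ -1}+\beta/2)^n$; $\phi^{[\beta]*}_m:=(\phi^{[\beta]}_m)^*$. For odd $n$, $b_n=\frac14\sum_i(-1)^i\phi_{ -i-n}\phi_i$,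 and $\theta^*=2\sum_{n>0\text{ odd}}(\beta/2)^nb_{ -n}/n$. -}

module Defs where

-- Concrete model of the neutral-fermion Fock space over ℚ, with all
-- β-dependent quantities expanded as formal power series in β
-- (a series is represented by its coefficient function ℕ → _, index = power of β).

open import Data.Nat as ℕ using (ℕ; zero; suc; _∸_; _≡ᵇ_; _<ᵇ_)
open import Data.Nat.Combinatorics using (_C_)
open import Data.Integer as ℤ using (ℤ; +_; -[1+_])
open import Data.Rational as ℚ using (ℚ; 0ℚ; 1ℚ; ½; _*_)
open import Data.List using (List; []; _∷_; _++_; map; concatMap; upTo; foldr)
open import Data.Product using (_×_; _,_)
open import Data.Bool using (Bool; true; false; if_then_else_; _∧_)

ℕtoℚ : ℕ → ℚ
ℕtoℚ n = + n ℚ./ 1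

recipℕ : ℕ → ℚ
recipℕ zero = 0ℚ
recipℕ (suc n) = + 1 ℚ./ suc n

powℚ : ℚ → ℕ → ℚ
powℚ q zero = 1ℚ
powℚ q (suc n) = q * powℚ q n

isEven : ℕ → Bool
isEven zero = true
isEven (suc n) with isEven n
... | true = false
... | false = true

sgnℕ : ℕ → ℚ
sgnℕ n = if isEven n then 1ℚ else ℚ.- 1ℚ

sgnℤ : ℤ → ℚ
sgnℤ n = sgnℕ ℤ.∣ n ∣

-- Fock space
-- A basis vector is a strictly decreasing list n₁ > n₂ > ⋯ > n_r ≥ 0,
-- standing for φ_{n₁} φ_{n₂} ⋯ φ_{n_r} |vac⟩ (these span C|vac⟩).
-- A vector is a finite formal ℚ-linear combination of basis vectors
-- (list concatenation = addition; no normalisation is needed since we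
-- only ever evaluate the linear functional ⟨vac| · ⟩).

Basis : Set
Basis = List ℕ

FVec : Set
FVec = List (ℚ × Basis)

vac : FVec
vac = (1ℚ , []) ∷ []

scale : ℚ → FVec → FVec
scale c = map (λ { (a , b) → (c * a , b) })

prefix : ℕ → FVec → FVec
prefix n = map (λ { (a , b) → (a , n ∷ b) })

-- φ_k, k ≥ 1 (creation): anticommute past larger indices; φ_k φ_k = 0
creat : ℕ → Basis → FVec
creat k [] = (1ℚ , k ∷ []) ∷ []
creat k (n ∷ L) =
  if n <ᵇ k then (1ℚ , k ∷ n ∷ L) ∷ []
  else if n ≡ᵇ k then []
  else scale (ℚ.- 1ℚ) (prefix n (creat k L))

-- φ_0 : anticommutes with φ_n (n ≥ 1), φ_0 φ_0 = 1
act0 : Basis → FVec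
act0 [] = (1ℚ , 0 ∷ []) ∷ []
act0 (n ∷ L) =
  if n ≡ᵇ 0 then (1ℚ , L) ∷ []
  else scale (ℚ.- 1ℚ) (prefix n (act0 L))

-- φ_{-k}, k ≥ 1 : φ_{-k} φ_n = - φ_n φ_{-k} + 2 (-1)^k δ_{n,k},  φ_{-k}|vac⟩ = 0
annih : ℕ → Basis → FVec
annih k [] = []
annih k (n ∷ L) =
  (if n ≡ᵇ k then (ℕtoℚ 2 * sgnℕ k , L) ∷ [] else [])
  ++ scale (ℚ.- 1ℚ) (prefix n (annih k L))

φB : ℤ → Basis → FVec
φB (+ zero) = act0
φB (+ suc k) = creat (suc k)
φB -[1+ k ] = annih (suc k)

φ : ℤ → FVec → FVec
φ n = concatMap (λ { (a , b) → scale a (φB n b) })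

vev : FVec → ℚ
vev = foldr (λ { (a , []) s → a ℚ.+ s ; (a , _ ∷ _) s → s }) 0ℚ

-- b_{-j} = (1/4) Σ_{i∈ℤ} (-1)^i φ_{j-i} φ_i  (j ≥ 1 odd; here n = -j).
-- On a basis vector with entries ≤ M only the terms -M ≤ i ≤ j + M can be
-- nonzero (φ_i kills it for i < -M; for i > j+M, φ_{j-i} kills φ_i|b⟩),
-- so the infinite sum is evaluated on that (exact) finite window.

sumℕ : List ℕ → ℕ
sumℕ = foldr ℕ._+_ 0

bNegB : ℕ → Basis → FVec
bNegB j b =
  scale (½ * ½)
    (concatMap (λ t → let i = (+ t) ℤ.- (+ M) in
                      scale (sgnℤ i) (φ ((+ j) ℤ.- i) (φB i b)))
               (upTo (suc (j ℕ.+ M ℕ.+ M))))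
  where M = sumℕ b

bNeg : ℕ → FVec → FVec
bNeg j = concatMap (λ { (a , b) → scale a (bNegB j b) })

OpSeries : Set
OpSeries = ℕ → FVec → FVec

_⊛_ : OpSeries → OpSeries → OpSeries
(X ⊛ Y) k v = concatMap (λ i → X i (Y (k ∸ i) v)) (upTo (suc k))

idS : OpSeries
idS zero v = v
idS (suc k) v = []

powS : ℕ → OpSeries → OpSeries
powS zero X = idS
powS (suc r) X = X ⊛ powS r X

negS : OpSeries → OpSeries
negS X k v = scale (ℚ.- 1ℚ) (X k v)

-- e^X = Σ_r X^r / r! ; for X with zero constant term (X_0 = 0), the
-- β^k-coefficient of X^r vanishes for r > k, so the sum is finite.
expS : OpSeries → OpSeries
expS X k v = concatMap (λ r → scale (recipℕ (r ℕ.!)) (powS r X k v)) (upTo (suc k))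

θ* : OpSeries
θ* k v = if isEven k then [] else scale (ℕtoℚ 2 * powℚ ½ k * recipℕ k) (bNeg k v)

-- fermion-valued formal power series in β: β^k-coefficient is a finite
-- ℚ-linear combination of generators φ_n

LinComb : Set
LinComb = List (ℚ × ℤ)

FSeries : Set
FSeries = ℕ → LinComb

toOp : FSeries → OpSeries
toOp F k v = concatMap (λ { (c , n) → scale c (φ n v) }) (F k)

starLC : LinComb → LinComb
starLC = map (λ { (c , n) → (c * sgnℤ n , ℤ.- n) })

starF : FSeries → FSeries
starF F k = starLC (F k)

-- φ^{(β)}_m for m ≥ 0: coefficient of z^m in Σ_{n≥0} φ_n (z+β/2)^n
--   = Σ_{k≥0} binom(m+k, m) (β/2)^k φ_{m+k}
φRound : ℕ → FSeries
φRound m k = (ℕtoℚ ((m ℕ.+ k) C m) * powℚ ½ k , + (m ℕ.+ k)) ∷ []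

-- φ^{[β]}_m, m ∈ ℤ:
--  m = q+1 ≥ 1 : coefficient of z^m in Σ_{n≥1} φ_n (z/(1+βz/2))^n
--               = Σ_{k=0}^{q} binom(q, k) (-β/2)^k φ_{m-k}
--  m = -p ≤ 0  : coefficient of z^{-p} in Σ_{n≥0} φ_{-n} (z^{-1}+β/2)^n
--               = Σ_{k≥0} binom(p+k, p) (β/2)^k φ_{-(p+k)}
φBracketNeg : ℕ → FSeries
φBracketNeg p k = (ℕtoℚ ((p ℕ.+ k) C p) * powℚ ½ k , ℤ.- (+ (p ℕ.+ k))) ∷ []

φBracket : ℤ → FSeries
φBracket (+ zero) = φBracketNeg 0
φBracket -[1+ q ] = φBracketNeg (suc q)
φBracket (+ suc q) k =
  if k ℕ.≤ᵇ q then (ℕtoℚ (q C k) * powℚ (ℚ.- ½) k , + (suc q ∸ k)) ∷ [] else []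

φBracketStar : ℤ → FSeries
φBracketStar m = starF (φBracket m)

vevCoeff : ℤ → ℕ → ℚ
vevCoeff m k =
  vev ((expS (negS θ*) ⊛ (toOp (φBracketStar m) ⊛ (toOp (φRound 0) ⊛ expS θ*))) k vac)

δCoeff : ℤ → ℕ → ℚ
δCoeff (+ zero) zero = 1ℚ
δCoeff _ _ = 0ℚ

{-# OPTIONS --safe #-}
module Submission where

-- Work coefficientwise in β in the concrete Fock space, acting on covectors by transposed
-- fermions. Since b₋ⱼ raises the energy, ⟨vac| θ* = 0 and e^{-θ*} drops out. As ⟨vac| φₙ = 0
-- for n > 0, ⟨vac| φ^{[β]*}ₘ reduces to ⟨vac| φ₀ when m = 0 (and then ⟨vac| φ₀ φ^{(β)}₀ e^{θ*} |vac⟩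
-- = ⟨vac| e^{θ*} |vac⟩ = 1), to 0 when m < 0, and to combinations of ⟨vac| φ₋ₙ, n ≥ 1, when
-- m > 0. In the last case only φ₀ and (β/2)ⁿ φₙ in φ^{(β)}₀ contribute. Using [b₋ⱼ, φ_y] = φ_{y+j}
-- for odd j, ⟨vac| φ₋ₙ φ₀ e^{θ*} |vac⟩ is minus the βⁿ-coefficient of e^{-τ}, τ = Σ_{j odd} 2 (β/2)ʲ / j,
-- and e^{-τ} = (1 - β/2)/(1 + β/2) because both solve the same linear ODE. Its βⁿ-coefficient
-- 2 (-1)ⁿ / 2ⁿ cancels (β/2)ⁿ ⟨vac| φ₋ₙ φₙ |vac⟩ = (β/2)ⁿ 2 (-1)ⁿ.

open import Defs
open import Data.Bool using (true; false; if_then_else_; not; T)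
open import Data.Empty using (⊥-elim)
open import Data.Integer as ℤ using (ℤ; +_; -[1+_])
import Data.Integer.Properties as ℤP
open import Algebra.Properties.AbelianGroup ℤP.+-0-abelianGroup using () renaming (∙-cancelʳ to ℤ+-cancelʳ)
open import Data.Integer.Tactic.RingSolver using () renaming (solve-∀ to ℤ-solve-∀)
open import Data.List using (List; []; _∷_; _++_; concatMap; upTo; applyUpTo; length)
open import Data.List.Properties using (∷-injectiveˡ)
open import Data.List.Relation.Unary.All as All using (All; []; _∷_)
open import Data.Nat as ℕ using (ℕ; zero; suc; _<ᵇ_; _≡ᵇ_; _<_; _≤_; z≤n; s≤s; _∸_; _!)
import Data.Nat.Coprimality as Cop
open import Data.Nat.Combinatorics using (_C_)
import Data.Nat.Properties as ℕP
open import Data.Nat.Tactic.RingSolver using () renaming (solve-∀ to ℕ-solve-∀)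
open import Data.Product using (Σ; _×_; _,_; proj₁; proj₂)
open import Data.Rational as ℚ using (ℚ; 0ℚ; 1ℚ; ½; _*_; _+_; -_; mkℚ)
open import Data.Rational.Properties
open import Data.Rational.Solver
open import Data.Sum using (inj₁; inj₂)
open import Data.Unit using (⊤; tt)
open import Relation.Binary using (tri<; tri≈; tri>)
open import Relation.Binary.PropositionalEquality
open import Relation.Nullary using (¬_; yes; no; does)
open +-*-Solver

ℕ+-exchange : ∀ m n o → m ℕ.+ (n ℕ.+ o) ≡ n ℕ.+ (m ℕ.+ o)
ℕ+-exchange = ℕ-solve-∀

ℤ+-exchange : ∀ (x y z : ℤ) → x ℤ.+ (y ℤ.+ z) ≡ y ℤ.+ (x ℤ.+ z)
ℤ+-exchange = ℤ-solve-∀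

[x+y]-y≡x : ∀ (x y : ℤ) → (x ℤ.+ y) ℤ.- y ≡ x
[x+y]-y≡x = ℤ-solve-∀

[x-y]+y≡x : ∀ (x y : ℤ) → (x ℤ.- y) ℤ.+ y ≡ x
[x-y]+y≡x = ℤ-solve-∀

x+y≡z⇒x≡z-y : ∀ x y z → x ℤ.+ y ≡ z → x ≡ z ℤ.- y
x+y≡z⇒x≡z-y x y z e = sym (trans (cong (ℤ._- y) (sym e)) ([x+y]-y≡x x y))

x≡z-y⇒x+y≡z : ∀ x y z → x ≡ z ℤ.- y → x ℤ.+ y ≡ z
x≡z-y⇒x+y≡z x y z e = trans (cong (ℤ._+ y) e) ([x-y]+y≡x z y)

a≡c+b⇒+a-+b≡+c : ∀ a b c → a ≡ c ℕ.+ b → + a ℤ.- + b ≡ + c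
a≡c+b⇒+a-+b≡+c .(c ℕ.+ b) b c refl rewrite ℤP.pos-+ c b = [x+y]-y≡x (+ c) (+ b)

b≡a+c⇒+a-+b≡-c : ∀ a b c → b ≡ a ℕ.+ c → + a ℤ.- + b ≡ ℤ.- (+ c)
b≡a+c⇒+a-+b≡-c a .(a ℕ.+ c) c refl rewrite ℤP.pos-+ a c = identity (+ a) (+ c)
  where
  identity : ∀ (x y : ℤ) → x ℤ.- (x ℤ.+ y) ≡ ℤ.- y
  identity = ℤ-solve-∀

+t-+N-injective : ∀ N {t t′} → + t ℤ.- + N ≡ + t′ ℤ.- + N → t ≡ t′
+t-+N-injective N {t} {t′} e = ℤP.+-injective (ℤ+-cancelʳ (ℤ.- + N) (+ t) (+ t′) e)

[x+y]-x≡y : ∀ (x y : ℤ) → (x ℤ.+ y) ℤ.- x ≡ y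
[x+y]-x≡y = ℤ-solve-∀

j-[y+j]≡-y : ∀ (j y : ℤ) → j ℤ.- (y ℤ.+ j) ≡ ℤ.- y
j-[y+j]≡-y = ℤ-solve-∀

j-[-y]≡y+j : ∀ (j y : ℤ) → j ℤ.- (ℤ.- y) ≡ y ℤ.+ j
j-[-y]≡y+j = ℤ-solve-∀

y+[j-i]≡0⇒i≡y+j : ∀ y j i → y ℤ.+ (j ℤ.- i) ≡ + 0 → i ≡ y ℤ.+ j
y+[j-i]≡0⇒i≡y+j y j i e = begin
  i                                     ≡⟨ identity y j i ⟩
  (y ℤ.+ j) ℤ.- (y ℤ.+ (j ℤ.- i))       ≡⟨ cong (λ z → (y ℤ.+ j) ℤ.- z) e ⟩
  (y ℤ.+ j) ℤ.- + 0                     ≡⟨ ℤP.+-identityʳ (y ℤ.+ j) ⟩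
  y ℤ.+ j                               ∎
  where
  open ≡-Reasoning
  identity : ∀ (y j i : ℤ) → i ≡ (y ℤ.+ j) ℤ.- (y ℤ.+ (j ℤ.- i))
  identity = ℤ-solve-∀

y+i≡0⇒i≡-y : ∀ y i → y ℤ.+ i ≡ + 0 → i ≡ ℤ.- y
y+i≡0⇒i≡-y y i e = begin
  i                       ≡⟨ identity y i ⟩
  ℤ.- y ℤ.+ (y ℤ.+ i)     ≡⟨ cong (ℤ._+_ (ℤ.- y)) e ⟩
  ℤ.- y ℤ.+ + 0           ≡⟨ ℤP.+-identityʳ (ℤ.- y) ⟩
  ℤ.- y                   ∎
  where
  open ≡-Reasoning
  identity : ∀ (y i : ℤ) → i ≡ ℤ.- y ℤ.+ (y ℤ.+ i)
  identity = ℤ-solve-∀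

-[1+n+k]≡-[1+n]-k : ∀ n k → -[1+ (n ℕ.+ k) ] ≡ -[1+ n ] ℤ.- + k
-[1+n+k]≡-[1+n]-k n k = trans (cong ℤ.-_ (ℤP.pos-+ (suc n) k)) (ℤP.neg-distrib-+ (+ suc n) (+ k))

k≡i+d⇒-d≡-k+i : ∀ k i d → k ≡ i ℕ.+ d → ℤ.- (+ d) ≡ ℤ.- (+ k) ℤ.+ + i
k≡i+d⇒-d≡-k+i .(i ℕ.+ d) i d refl rewrite ℤP.pos-+ i d = identity (+ i) (+ d)
  where
  identity : ∀ (i d : ℤ) → ℤ.- d ≡ ℤ.- (i ℤ.+ d) ℤ.+ i
  identity = ℤ-solve-∀

T⇒≡true : ∀ {b} → T b → b ≡ true
T⇒≡true {true} _ = refl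

¬T⇒≡false : ∀ {b} → ¬ T b → b ≡ false
¬T⇒≡false {false} _ = refl
¬T⇒≡false {true} f = ⊥-elim (f tt)

≮⇒<ᵇ≡false : ∀ {m n} → ¬ (m < n) → (m <ᵇ n) ≡ false
≮⇒<ᵇ≡false {m} {n} f = ¬T⇒≡false (λ t → f (ℕP.<ᵇ⇒< m n t))

≢⇒≡ᵇ≡false : ∀ {m n} → ¬ (m ≡ n) → (m ≡ᵇ n) ≡ false
≢⇒≡ᵇ≡false {m} {n} f = ¬T⇒≡false (λ t → f (ℕP.≡ᵇ⇒≡ m n t))

≡ᵇ-refl : ∀ n → (n ≡ᵇ n) ≡ true
≡ᵇ-refl n = T⇒≡true (ℕP.≡⇒≡ᵇ n n refl)

∸-suc-< : ∀ m i r → suc i < suc m → m < suc r → m ∸ suc i < r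
∸-suc-< (suc m') i r q p = ℕP.≤-trans (s≤s (ℕP.m∸n≤m m' i)) (ℕP.≤-pred p)
∸-suc-< zero i r (s≤s ()) p

∸-suc-≤ : ∀ k i → suc i ≤ k → suc (k ∸ suc i) ≤ k
∸-suc-≤ (suc k') i (s≤s _) = s≤s (ℕP.m∸n≤m k' i)

suc-+-∸ : ∀ i d → suc (i ℕ.+ d) ∸ i ≡ suc d
suc-+-∸ zero d = refl
suc-+-∸ (suc i) d = suc-+-∸ i d

isEven-suc : ∀ n → isEven (suc n) ≡ not (isEven n)
isEven-suc n with isEven n
... | true = refl
... | false = refl

a≡b+c⇒b≤a : ∀ {a b c} → a ≡ b ℕ.+ c → b ≤ a
a≡b+c⇒b≤a {b = b} {c} refl = ℕP.m≤m+n b c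

neg-involutive : ∀ x → - - x ≡ x
neg-involutive x = solve 1 (λ x → :- :- x := x) refl x

neg-involutive-+ : ∀ x y → - - x + - - y ≡ x + y
neg-involutive-+ x y = solve 2 (λ x y → :- :- x :+ :- :- y := x :+ y) refl x y

neg-+-negneg≡0 : ∀ x → - x + - - x ≡ 0ℚ
neg-+-negneg≡0 x = solve 1 (λ x → :- x :+ :- :- x := con 0ℚ) refl x

x+y≡0⇒y+x≡0 : ∀ x y → x + y ≡ 0ℚ → y + x ≡ 0ℚ
x+y≡0⇒y+x≡0 x y e = trans (+-comm y x) e

a+b≡c⇒a≡c-b : ∀ a b c → a + b ≡ c → a ≡ c + - b
a+b≡c⇒a≡c-b a b c e = trans (solve 2 (λ a b → a := (a :+ b) :+ :- b) refl a b) (cong (_+ - b) e)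

sgnℕ-suc : ∀ n → sgnℕ (suc n) ≡ - sgnℕ n
sgnℕ-suc n with isEven n
... | true = refl
... | false = refl

sgnℤ-suc : ∀ a → sgnℤ (ℤ.suc a) ≡ - sgnℤ a
sgnℤ-suc (+ n) = sgnℕ-suc n
sgnℤ-suc -[1+ zero ] = refl
sgnℤ-suc -[1+ suc n ] = trans (sym (neg-involutive (sgnℕ (suc n)))) (cong -_ (sym (sgnℕ-suc (suc n))))

sgnℤ-pred : ∀ a → sgnℤ (ℤ.pred a) ≡ - sgnℤ a
sgnℤ-pred a = trans (sym (neg-involutive (sgnℤ (ℤ.pred a)))) (cong -_ (trans (sym (sgnℤ-suc (ℤ.pred a))) (cong sgnℤ (ℤP.suc-pred a))))

sgnℤ-+ : ∀ a b → sgnℤ (a ℤ.+ b) ≡ sgnℤ a * sgnℤ b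
sgnℤ-+ a (+ zero) = trans (cong sgnℤ (ℤP.+-identityʳ a)) (sym (*-identityʳ _))
sgnℤ-+ a (+ suc n) = begin
  sgnℤ (a ℤ.+ + suc n)  ≡⟨ cong sgnℤ (ℤ+-exchange a (+ 1) (+ n)) ⟩
  sgnℤ (ℤ.suc (a ℤ.+ + n)) ≡⟨ sgnℤ-suc (a ℤ.+ + n) ⟩
  - sgnℤ (a ℤ.+ + n)      ≡⟨ cong -_ (sgnℤ-+ a (+ n)) ⟩
  - (sgnℤ a * sgnℕ n)      ≡⟨ solve 2 (λ x y → :- (x :* y) := x :* (:- y)) refl (sgnℤ a) (sgnℕ n) ⟩
  sgnℤ a * - sgnℕ n        ≡⟨ cong (sgnℤ a *_) (sym (sgnℕ-suc n)) ⟩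
  sgnℤ a * sgnℕ (suc n)    ∎ where open ≡-Reasoning
sgnℤ-+ a -[1+ zero ] = trans (cong sgnℤ (ℤP.+-comm a -[1+ 0 ])) (trans (sgnℤ-pred a) (solve 1 (λ x → :- x := x :* (:- con 1ℚ)) refl (sgnℤ a)))
sgnℤ-+ a -[1+ suc n ] = begin
  sgnℤ (a ℤ.+ -[1+ suc n ])  ≡⟨ cong sgnℤ (ℤ+-exchange a -[1+ 0 ] -[1+ n ]) ⟩
  sgnℤ (ℤ.pred (a ℤ.+ -[1+ n ])) ≡⟨ sgnℤ-pred (a ℤ.+ -[1+ n ]) ⟩
  - sgnℤ (a ℤ.+ -[1+ n ])      ≡⟨ cong -_ (sgnℤ-+ a -[1+ n ]) ⟩
  - (sgnℤ a * sgnℕ (suc n))      ≡⟨ solve 2 (λ x y → :- (x :* y) := x :* (:- y)) refl (sgnℤ a) (sgnℕ (suc n)) ⟩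
  sgnℤ a * - sgnℕ (suc n)        ≡⟨ cong (sgnℤ a *_) (sym (sgnℕ-suc (suc n))) ⟩
  sgnℤ a * sgnℕ (suc (suc n))    ∎ where open ≡-Reasoning

sgnℤ-neg : ∀ a → sgnℤ (ℤ.- a) ≡ sgnℤ a
sgnℤ-neg (+ zero) = refl
sgnℤ-neg (+ suc n) = refl
sgnℤ-neg -[1+ n ] = refl

sgnℕ-square : ∀ n → sgnℕ n * sgnℕ n ≡ 1ℚ
sgnℕ-square n with isEven n
... | true = refl
... | false = refl

sgnℤ-square : ∀ a → sgnℤ a * sgnℤ a ≡ 1ℚ
sgnℤ-square a = sgnℕ-square ℤ.∣ a ∣

sgnℕ-odd : ∀ j → isEven j ≡ false → sgnℕ j ≡ - 1ℚ
sgnℕ-odd j e rewrite e = refl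

twoSign : ℕ → ℚ
twoSign k = ℕtoℚ 2 * sgnℕ k

twoSign-+-odd : ∀ n k → isEven k ≡ false → twoSign (suc n ℕ.+ k) ≡ - twoSign (suc n)
twoSign-+-odd n k e = trans (cong (ℕtoℚ 2 *_) (trans (sgnℤ-+ (+ suc n) (+ k)) (cong (sgnℕ (suc n) *_) (sgnℕ-odd k e))))
                      (solve 2 (λ a s → a :* (s :* (:- con 1ℚ)) := :- (a :* s)) refl (ℕtoℚ 2) (sgnℕ (suc n)))

ℕtoℚ≡mkℚ : ∀ n → ℕtoℚ n ≡ mkℚ (ℤ.+ n) 0 (Cop.sym (Cop.1-coprimeTo n))
ℕtoℚ≡mkℚ n = normalize-coprime (Cop.sym (Cop.1-coprimeTo n))

ℕtoℚ-+ : ∀ a b → ℕtoℚ (a ℕ.+ b) ≡ ℕtoℚ a + ℕtoℚ b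
ℕtoℚ-+ a b = sym (trans (cong₂ _+_ (ℕtoℚ≡mkℚ a) (ℕtoℚ≡mkℚ b))
                   (cong (λ z → z ℚ./ 1) (cong₂ ℤ._+_ (ℤP.*-identityʳ (ℤ.+ a)) (ℤP.*-identityʳ (ℤ.+ b)))))

ℕtoℚ-* : ∀ a b → ℕtoℚ (a ℕ.* b) ≡ ℕtoℚ a * ℕtoℚ b
ℕtoℚ-* a b = sym (trans (cong₂ _*_ (ℕtoℚ≡mkℚ a) (ℕtoℚ≡mkℚ b)) (cong (λ z → z ℚ./ 1) (sym (ℤP.pos-* a b))))

ℕtoℚ-suc : ∀ n → ℕtoℚ (suc n) ≡ 1ℚ + ℕtoℚ n
ℕtoℚ-suc n = ℕtoℚ-+ 1 n

recipℕ≡mkℚ : ∀ n → recipℕ (suc n) ≡ mkℚ (ℤ.+ 1) n (Cop.1-coprimeTo (suc n))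
recipℕ≡mkℚ n = normalize-coprime (Cop.1-coprimeTo (suc n))

recipℕ-inverseˡ : ∀ n → recipℕ (suc n) * ℕtoℚ (suc n) ≡ 1ℚ
recipℕ-inverseˡ n rewrite recipℕ≡mkℚ n | ℕtoℚ≡mkℚ (suc n) = *-inverseˡ (mkℚ (ℤ.+ suc n) 0 (Cop.sym (Cop.1-coprimeTo (suc n))))

!≡suc : ∀ r → Σ ℕ (λ m → r ! ≡ suc m)
!≡suc r with r ! | ℕP.1≤n! r
... | suc m | _ = m , refl

recipℕ-inverseˡ′ : ∀ n → Σ ℕ (λ m → n ≡ suc m) → recipℕ n * ℕtoℚ n ≡ 1ℚ
recipℕ-inverseˡ′ .(suc m) (m , refl) = recipℕ-inverseˡ m

recipℕ-!-suc : ∀ r → recipℕ (suc r !) * ℕtoℚ (suc r) ≡ recipℕ (r !)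
recipℕ-!-suc r = begin
  A * x
    ≡⟨ sym (trans (cong (λ z → (A * x) * z) (trans (*-comm y B) (recipℕ-inverseˡ′ (r !) (!≡suc r)))) (*-identityʳ (A * x))) ⟩
  (A * x) * (y * B)
    ≡⟨ solve 4 (λ A x y B → (A :* x) :* (y :* B) := (A :* (x :* y)) :* B) refl A x y B ⟩
  (A * (x * y)) * B
    ≡⟨ cong (λ z → (A * z) * B) (sym (ℕtoℚ-* (suc r) (r !))) ⟩
  (A * ℕtoℚ (suc r !)) * B
    ≡⟨ cong (_* B) (recipℕ-inverseˡ′ (suc r !) (!≡suc (suc r))) ⟩
  1ℚ * B
    ≡⟨ *-identityˡ B ⟩
  B ∎ where
    open ≡-Reasoning
    A = recipℕ (suc r !)
    B = recipℕ (r !)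
    x = ℕtoℚ (suc r)
    y = ℕtoℚ (r !)

δℤ : ℤ → ℤ → ℚ
δℤ a b = if does (a ℤ.≟ b) then 1ℚ else 0ℚ

δℤ-≡ : ∀ {a b} → a ≡ b → δℤ a b ≡ 1ℚ
δℤ-≡ {a} {b} e with a ℤ.≟ b
... | yes _ = refl
... | no ne = ⊥-elim (ne e)

δℤ-≢ : ∀ {a b} → ¬ (a ≡ b) → δℤ a b ≡ 0ℚ
δℤ-≢ {a} {b} ne with a ℤ.≟ b
... | yes e = ⊥-elim (ne e)
... | no _ = refl

δℤ-cong-⇔ : ∀ {a b c d} → (a ≡ b → c ≡ d) → (c ≡ d → a ≡ b) → δℤ a b ≡ δℤ c d
δℤ-cong-⇔ {a} {b} {c} {d} f g with a ℤ.≟ b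
... | yes e = sym (δℤ-≡ (f e))
... | no ne = sym (δℤ-≢ (λ e → ne (g e)))

∑ₗ : ∀ {A : Set} → List A → (A → ℚ) → ℚ
∑ₗ [] f = 0ℚ
∑ₗ (x ∷ xs) f = f x + ∑ₗ xs f

∑ : ℕ → (ℕ → ℚ) → ℚ
∑ zero f = 0ℚ
∑ (suc n) f = f 0 + ∑ n (λ i → f (suc i))

∑ₗ-applyUpTo : ∀ (h : ℕ → ℕ) n f → ∑ₗ (applyUpTo h n) f ≡ ∑ n (λ i → f (h i))
∑ₗ-applyUpTo h zero f = refl
∑ₗ-applyUpTo h (suc n) f = cong (λ y → f (h 0) + y) (∑ₗ-applyUpTo (λ i → h (suc i)) n f)

∑ₗ-upTo : ∀ n f → ∑ₗ (upTo n) f ≡ ∑ n f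
∑ₗ-upTo n f = ∑ₗ-applyUpTo (λ i → i) n f

∑-cong : ∀ n {f g} → (∀ i → f i ≡ g i) → ∑ n f ≡ ∑ n g
∑-cong zero e = refl
∑-cong (suc n) e = cong₂ _+_ (e 0) (∑-cong n (λ i → e (suc i)))

∑-cong-< : ∀ n {f g} → (∀ i → i < n → f i ≡ g i) → ∑ n f ≡ ∑ n g
∑-cong-< zero e = refl
∑-cong-< (suc n) e = cong₂ _+_ (e 0 (s≤s z≤n)) (∑-cong-< n (λ i p → e (suc i) (s≤s p)))

∑-zero : ∀ n {f} → (∀ i → f i ≡ 0ℚ) → ∑ n f ≡ 0ℚ
∑-zero zero e = refl
∑-zero (suc n) e rewrite e 0 | ∑-zero n (λ i → e (suc i)) = refl

∑-zero-< : ∀ n {f} → (∀ i → i < n → f i ≡ 0ℚ) → ∑ n f ≡ 0ℚ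
∑-zero-< n {f} e = trans (∑-cong-< n e) (∑-zero n (λ _ → refl))

∑-+ : ∀ n f g → ∑ n (λ i → f i + g i) ≡ ∑ n f + ∑ n g
∑-+ zero f g = sym (+-identityˡ 0ℚ)
∑-+ (suc n) f g rewrite ∑-+ n (λ i → f (suc i)) (λ i → g (suc i)) =
  solve 4 (λ a b c d → (a :+ b) :+ (c :+ d) := (a :+ c) :+ (b :+ d)) refl (f 0) (g 0) (∑ n (λ i → f (suc i))) (∑ n (λ i → g (suc i)))

∑-* : ∀ n c f → ∑ n (λ i → c * f i) ≡ c * ∑ n f
∑-* zero c f = sym (*-zeroʳ c)
∑-* (suc n) c f rewrite ∑-* n c (λ i → f (suc i)) = sym (*-distribˡ-+ c (f 0) _)

∑-neg : ∀ n f → ∑ n (λ i → - f i) ≡ - ∑ n f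
∑-neg n f = trans (∑-cong n (λ i → solve 1 (λ x → :- x := (:- con 1ℚ) :* x) refl (f i)))
             (trans (∑-* n (- 1ℚ) f) (solve 1 (λ x → (:- con 1ℚ) :* x := :- x) refl (∑ n f)))

∑-split : ∀ a b f → ∑ (a ℕ.+ b) f ≡ ∑ a f + ∑ b (λ i → f (a ℕ.+ i))
∑-split zero b f = sym (+-identityˡ _)
∑-split (suc a) b f rewrite ∑-split a b (λ i → f (suc i)) = sym (+-assoc (f 0) _ _)

∑-last : ∀ n f → ∑ (suc n) f ≡ ∑ n f + f n
∑-last zero f = trans (+-identityʳ (f 0)) (sym (+-identityˡ (f 0)))
∑-last (suc n) f rewrite ∑-last n (λ i → f (suc i)) = sym (+-assoc (f 0) _ _)

∑-single : ∀ n j f → j < n → (∀ i → i < n → ¬ (i ≡ j) → f i ≡ 0ℚ) → ∑ n f ≡ f j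
∑-single (suc n) zero f p e =
  trans (cong (λ y → f 0 + y) (∑-zero-< n (λ i q → e (suc i) (s≤s q) (λ ())))) (+-identityʳ _)
∑-single (suc n) (suc j) f (s≤s p) e =
  trans (cong (λ y → y + ∑ n (λ i → f (suc i))) (e 0 (s≤s z≤n) (λ ())))
   (trans (+-identityˡ _) (∑-single n j (λ i → f (suc i)) p (λ i q ne → e (suc i) (s≤s q) (λ x → ne (ℕP.suc-injective x)))))

∑-vanishing-tail : ∀ n d F → (∀ r → F (n ℕ.+ r) ≡ 0ℚ) → ∑ (n ℕ.+ d) F ≡ ∑ n F
∑-vanishing-tail n d F z = trans (∑-split n d F) (trans (cong (_+_ (∑ n F)) (∑-zero d z)) (+-identityʳ _))

∑ₗ-zero : ∀ {A : Set} (xs : List A) f → (∀ x → f x ≡ 0ℚ) → ∑ₗ xs f ≡ 0ℚ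
∑ₗ-zero [] f z = refl
∑ₗ-zero (x ∷ xs) f z rewrite z x | ∑ₗ-zero xs f z = refl

∑ₗ-zero-All : ∀ {A : Set} (xs : List A) f → All (λ x → f x ≡ 0ℚ) xs → ∑ₗ xs f ≡ 0ℚ
∑ₗ-zero-All [] f [] = refl
∑ₗ-zero-All (x ∷ xs) f (p ∷ ps) rewrite p | ∑ₗ-zero-All xs f ps = refl

-- A covector is given by its values on basis vectors; pair g v is ⟨g|v⟩.
pair : (Basis → ℚ) → FVec → ℚ
pair g [] = 0ℚ
pair g ((a , b) ∷ v) = a * g b + pair g v

pair-++ : ∀ g v w → pair g (v ++ w) ≡ pair g v + pair g w
pair-++ g [] w = sym (+-identityˡ _)
pair-++ g ((a , b) ∷ v) w rewrite pair-++ g v w = sym (+-assoc (a * g b) (pair g v) (pair g w))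

pair-scale : ∀ g c v → pair g (scale c v) ≡ c * pair g v
pair-scale g c [] = sym (*-zeroʳ c)
pair-scale g c ((a , b) ∷ v) rewrite pair-scale g c v =
  solve 4 (λ c a x y → c :* a :* x :+ c :* y := c :* (a :* x :+ y)) refl c a (g b) (pair g v)

pair-prefix : ∀ g n v → pair g (prefix n v) ≡ pair (λ x → g (n ∷ x)) v
pair-prefix g n [] = refl
pair-prefix g n ((a , b) ∷ v) rewrite pair-prefix g n v = refl

pair-cong : ∀ {g h} v → (∀ x → g x ≡ h x) → pair g v ≡ pair h v
pair-cong [] e = refl
pair-cong ((a , b) ∷ v) e rewrite e b | pair-cong v e = refl

pair-scale-neg : ∀ g v → pair g (scale (- 1ℚ) v) ≡ - pair g v
pair-scale-neg g v = trans (pair-scale g (- 1ℚ) v) (solve 1 (λ x → (:- con 1ℚ) :* x := :- x) refl (pair g v))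

pair-negPrefix : ∀ g n v → pair g (scale (- 1ℚ) (prefix n v)) ≡ - pair (λ x → g (n ∷ x)) v
pair-negPrefix g n v = trans (pair-scale-neg g (prefix n v)) (cong -_ (pair-prefix g n v))

pair-singleton : ∀ g c b → pair g ((c , b) ∷ []) ≡ c * g b
pair-singleton g c b = +-identityʳ _

pair-basis : ∀ g b → pair g ((1ℚ , b) ∷ []) ≡ g b
pair-basis g b = trans (pair-singleton g 1ℚ b) (*-identityˡ _)

pair-0 : ∀ v → pair (λ _ → 0ℚ) v ≡ 0ℚ
pair-0 [] = refl
pair-0 ((a , b) ∷ v) rewrite pair-0 v = trans (+-identityʳ _) (*-zeroʳ a)

pair-+ : ∀ g h v → pair (λ x → g x + h x) v ≡ pair g v + pair h v
pair-+ g h [] = refl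
pair-+ g h ((a , b) ∷ v) rewrite pair-+ g h v =
  solve 5 (λ a x y u w → a :* (x :+ y) :+ (u :+ w) := (a :* x :+ u) :+ (a :* y :+ w)) refl a (g b) (h b) (pair g v) (pair h v)

pair-* : ∀ c g v → pair (λ x → c * g x) v ≡ c * pair g v
pair-* c g [] = sym (*-zeroʳ c)
pair-* c g ((a , b) ∷ v) rewrite pair-* c g v =
  solve 4 (λ c a x y → a :* (c :* x) :+ c :* y := c :* (a :* x :+ y)) refl c a (g b) (pair g v)

pair-concatMap-scale : ∀ g (h : ℚ × Basis → FVec) (F : Basis → FVec) → (∀ a b → h (a , b) ≡ scale a (F b)) →
       ∀ v → pair g (concatMap h v) ≡ pair (λ b → pair g (F b)) v
pair-concatMap-scale g h F e [] = refl
pair-concatMap-scale g h F e ((a , b) ∷ v) =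
  trans (pair-++ g (h (a , b)) (concatMap h v))
        (cong₂ _+_ (trans (cong (pair g) (e a b)) (pair-scale g a (F b))) (pair-concatMap-scale g h F e v))

pair-concatMap : ∀ {A : Set} g (f : A → FVec) xs → pair g (concatMap f xs) ≡ ∑ₗ xs (λ x → pair g (f x))
pair-concatMap g f [] = refl
pair-concatMap g f (x ∷ xs) = trans (pair-++ g (f x) (concatMap f xs)) (cong (λ y → pair g (f x) + y) (pair-concatMap g f xs))

pair-neg : ∀ h v → pair (λ x → - h x) v ≡ - pair h v
pair-neg h v = trans (pair-cong v (λ x → solve 1 (λ y → :- y := (:- con 1ℚ) :* y) refl (h x)))
              (trans (pair-* (- 1ℚ) h v) (solve 1 (λ y → (:- con 1ℚ) :* y := :- y) refl (pair h v)))

pair-cong-neg : ∀ (op : Basis → FVec) (h : Basis → ℚ) (h' : Basis → ℚ) x →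
          (∀ y → h y ≡ - h' y) → pair h (op x) ≡ - pair h' (op x)
pair-cong-neg O h h' x e = trans (pair-cong (O x) e) (pair-neg h' (O x))

pair-∑ : ∀ n (F : ℕ → Basis → ℚ) v → pair (λ x → ∑ n (λ t → F t x)) v ≡ ∑ n (λ t → pair (F t) v)
pair-∑ n F [] = sym (∑-zero n (λ _ → refl))
pair-∑ n F ((a , b) ∷ v) rewrite pair-∑ n F v =
  sym (trans (∑-+ n (λ t → a * F t b) (λ t → pair (F t) v)) (cong (_+ ∑ n (λ t → pair (F t) v)) (∑-* n a (λ t → F t b))))

vacᵀ : Basis → ℚ
vacᵀ [] = 1ℚ
vacᵀ (_ ∷ _) = 0ℚ

vev≡pair-vacᵀ : ∀ v → vev v ≡ pair vacᵀ v
vev≡pair-vacᵀ [] = refl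
vev≡pair-vacᵀ ((a , []) ∷ v) rewrite vev≡pair-vacᵀ v | *-identityʳ a = refl
vev≡pair-vacᵀ ((a , x ∷ b) ∷ v) rewrite vev≡pair-vacᵀ v | *-zeroʳ a = sym (+-identityˡ _)

All<⇒≢ : ∀ {k} {ns : List ℕ} → All (_< k) ns → All (λ e → ¬ (e ≡ k)) ns
All<⇒≢ [] = []
All<⇒≢ (p ∷ ps) = ℕP.<⇒≢ p ∷ All<⇒≢ ps

All<0⇒[] : ∀ {ns : List ℕ} → All (_< 0) ns → ns ≡ []
All<0⇒[] [] = refl
All<0⇒[] (() ∷ _)

All<-∷ : ∀ {n k} {ns : List ℕ} → n < k → All (_< n) ns → All (_< k) (n ∷ ns)
All<-∷ {n} {k} p ps = p ∷ All.map (λ q → ℕP.<-trans q p) ps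

All≤sumℕ : ∀ ns → All (_≤ sumℕ ns) ns
All≤sumℕ [] = []
All≤sumℕ (n ∷ ns) = ℕP.m≤m+n n (sumℕ ns) ∷ All.map (λ p → ℕP.≤-trans p (ℕP.m≤n+m (sumℕ ns) n)) (All≤sumℕ ns)

-- The anticommutation relations hold on normally ordered basis vectors, i.e. strictly decreasing lists.
Decreasing : Basis → Set
Decreasing [] = ⊤
Decreasing (n ∷ ns) = All (_< n) ns × Decreasing ns

-- Xᵀ g is the covector ⟨g| X, so that pair g (X v) ≡ pair (Xᵀ g) v.
creatᵀ : ℕ → (Basis → ℚ) → Basis → ℚ
creatᵀ k g b = pair g (creat k b)

annihᵀ : ℕ → (Basis → ℚ) → Basis → ℚ
annihᵀ k g b = pair g (annih k b)

act0ᵀ : (Basis → ℚ) → Basis → ℚ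
act0ᵀ g b = pair g (act0 b)

creat-< : ∀ {k n} ns → n < k → creat k (n ∷ ns) ≡ (1ℚ , k ∷ n ∷ ns) ∷ []
creat-< {k} {n} ns p rewrite T⇒≡true (ℕP.<⇒<ᵇ p) = refl

creat-self : ∀ k ns → creat k (k ∷ ns) ≡ []
creat-self k ns rewrite ≮⇒<ᵇ≡false {k} {k} (ℕP.<-irrefl refl) | ≡ᵇ-refl k = refl

creat-> : ∀ {k n} ns → k < n → creat k (n ∷ ns) ≡ scale (- 1ℚ) (prefix n (creat k ns))
creat-> {k} {n} ns p rewrite ≮⇒<ᵇ≡false (ℕP.<⇒≯ p) | ≢⇒≡ᵇ≡false {n} {k} (λ e → ℕP.<⇒≢ p (sym e)) = refl

creatᵀ-[] : ∀ k g → creatᵀ k g [] ≡ g (k ∷ [])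
creatᵀ-[] k g = pair-basis g (k ∷ [])

creatᵀ-< : ∀ {k n} g ns → n < k → creatᵀ k g (n ∷ ns) ≡ g (k ∷ n ∷ ns)
creatᵀ-< g ns p rewrite creat-< ns p = pair-basis g _

creatᵀ-self : ∀ k g ns → creatᵀ k g (k ∷ ns) ≡ 0ℚ
creatᵀ-self k g ns rewrite creat-self k ns = refl

creatᵀ-> : ∀ {k n} g ns → k < n → creatᵀ k g (n ∷ ns) ≡ - creatᵀ k (λ x → g (n ∷ x)) ns
creatᵀ-> {k} {n} g ns p rewrite creat-> ns p = pair-negPrefix g n (creat k ns)

creatᵀ-All< : ∀ {k} g ns → All (_< k) ns → creatᵀ k g ns ≡ g (k ∷ ns)
creatᵀ-All< g [] _ = creatᵀ-[] _ g
creatᵀ-All< g (n ∷ ns) (p ∷ _) = creatᵀ-< g ns p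

annihᵀ-≢ : ∀ {k n} g ns → ¬ (n ≡ k) → annihᵀ k g (n ∷ ns) ≡ - annihᵀ k (λ x → g (n ∷ x)) ns
annihᵀ-≢ {k} {n} g ns ne rewrite ≢⇒≡ᵇ≡false ne = pair-negPrefix g n (annih k ns)

annihᵀ-absent : ∀ {k} g ns → All (λ e → ¬ (e ≡ k)) ns → annihᵀ k g ns ≡ 0ℚ
annihᵀ-absent g [] _ = refl
annihᵀ-absent g (n ∷ ns) (p ∷ ps) rewrite annihᵀ-≢ g ns p | annihᵀ-absent (λ x → g (n ∷ x)) ns ps = refl

annihᵀ-self : ∀ {k} g ns → All (_< k) ns → annihᵀ k g (k ∷ ns) ≡ ℕtoℚ 2 * sgnℕ k * g ns
annihᵀ-self {k} g ns ps rewrite ≡ᵇ-refl k =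
  trans (cong (λ y → ℕtoℚ 2 * sgnℕ k * g ns + y)
          (trans (pair-negPrefix g k (annih k ns)) (cong -_ (annihᵀ-absent (λ x → g (k ∷ x)) ns (All<⇒≢ ps)))))
        (+-identityʳ _)

act0ᵀ-[] : ∀ g → act0ᵀ g [] ≡ g (0 ∷ [])
act0ᵀ-[] g = pair-basis g _

act0ᵀ-0 : ∀ g ns → act0ᵀ g (0 ∷ ns) ≡ g ns
act0ᵀ-0 g ns = pair-basis g ns

act0ᵀ-suc : ∀ g n ns → act0ᵀ g (suc n ∷ ns) ≡ - act0ᵀ (λ x → g (suc n ∷ x)) ns
act0ᵀ-suc g n ns = pair-negPrefix g (suc n) (act0 ns)

AllTerms : (Basis → Set) → FVec → Set
AllTerms P v = All (λ t → P (proj₂ t)) v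

pair-cong-on : ∀ {P : Basis → Set} {g h} v → AllTerms P v → (∀ x → P x → g x ≡ h x) → pair g v ≡ pair h v
pair-cong-on [] _ e = refl
pair-cong-on ((a , b) ∷ v) (p ∷ ps) e = cong₂ _+_ (cong (a *_) (e b p)) (pair-cong-on v ps e)

AllTerms-++ : ∀ {P} v w → AllTerms P v → AllTerms P w → AllTerms P (v ++ w)
AllTerms-++ [] w _ q = q
AllTerms-++ (x ∷ v) w (p ∷ ps) q = p ∷ AllTerms-++ v w ps q

AllTerms-scale : ∀ {P} c v → AllTerms P v → AllTerms P (scale c v)
AllTerms-scale c [] _ = []
AllTerms-scale c ((a , b) ∷ v) (p ∷ ps) = p ∷ AllTerms-scale c v ps

AllTerms-prefix : ∀ {P} n v → AllTerms (λ x → P (n ∷ x)) v → AllTerms P (prefix n v)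
AllTerms-prefix n [] _ = []
AllTerms-prefix n ((a , b) ∷ v) (p ∷ ps) = p ∷ AllTerms-prefix n v ps

AllTerms-negPrefix : ∀ {P} n v → AllTerms (λ x → P (n ∷ x)) v → AllTerms P (scale (- 1ℚ) (prefix n v))
AllTerms-negPrefix n v p = AllTerms-scale (- 1ℚ) (prefix n v) (AllTerms-prefix n v p)

AllTerms-map : ∀ {P Q : Basis → Set} → (∀ x → P x → Q x) → ∀ v → AllTerms P v → AllTerms Q v
AllTerms-map f [] [] = []
AllTerms-map f ((a , b) ∷ v) (p ∷ ps) = f b p ∷ AllTerms-map f v ps

AllTerms-zip : ∀ {P Q : Basis → Set} v → AllTerms P v → AllTerms Q v → AllTerms (λ x → P x × Q x) v
AllTerms-zip [] [] [] = []
AllTerms-zip (_ ∷ v) (p ∷ ps) (q ∷ qs) = (p , q) ∷ AllTerms-zip v ps qs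

creat-all : ∀ {P : ℕ → Set} {k} ns → All P ns → P k → AllTerms (All P) (creat k ns)
creat-all [] _ pk = (pk ∷ []) ∷ []
creat-all {P} {k} (n ∷ ns) (p ∷ ps) pk with ℕP.<-cmp n k
... | tri< a _ _ rewrite creat-< ns a = (pk ∷ p ∷ ps) ∷ []
... | tri≈ _ refl _ rewrite creat-self n ns = []
... | tri> _ _ c rewrite creat-> ns c =
  AllTerms-negPrefix n (creat k ns) (All.map (λ q → p ∷ q) (creat-all ns ps pk))

annih-all : ∀ {P : ℕ → Set} k ns → All P ns → AllTerms (All P) (annih k ns)
annih-all k [] _ = []
annih-all k (n ∷ ns) (p ∷ ps) with n ≡ᵇ k
... | true = ps ∷ AllTerms-negPrefix n (annih k ns) (All.map (λ q → p ∷ q) (annih-all k ns ps))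
... | false = AllTerms-negPrefix n (annih k ns) (All.map (λ q → p ∷ q) (annih-all k ns ps))

act0-all : ∀ {P : ℕ → Set} ns → All P ns → P 0 → AllTerms (All P) (act0 ns)
act0-all [] _ z = (z ∷ []) ∷ []
act0-all (zero ∷ ns) (p ∷ ps) z = ps ∷ []
act0-all (suc n ∷ ns) (p ∷ ps) z = AllTerms-negPrefix (suc n) (act0 ns) (All.map (λ q → p ∷ q) (act0-all ns ps z))

creat-length : ∀ k x → AllTerms (λ z → length z ≡ suc (length x)) (creat k x)
creat-length k [] = refl ∷ []
creat-length k (n ∷ ns) with ℕP.<-cmp n k
... | tri< a _ _ rewrite creat-< ns a = refl ∷ []
... | tri≈ _ refl _ rewrite creat-self n ns = []
... | tri> _ _ c rewrite creat-> ns c =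
  AllTerms-negPrefix n (creat k ns) (AllTerms-map (λ z e → cong suc e) (creat k ns) (creat-length k ns))

vacᵀ-creat : ∀ k x → pair vacᵀ (creat k x) ≡ 0ℚ
vacᵀ-creat k x = trans (pair-cong-on (creat k x) (creat-length k x) f) (pair-0 (creat k x))
  where
    f : ∀ z → length z ≡ suc (length x) → vacᵀ z ≡ 0ℚ
    f [] ()
    f (_ ∷ _) _ = refl

-- Canonical anticommutation relations
creatᵀ-anticomm-All< : ∀ k l g b → All (_< k) b → All (_< l) b → creatᵀ l (creatᵀ k g) b + creatᵀ k (creatᵀ l g) b ≡ 0ℚ
creatᵀ-anticomm-All< k l g b pk pl with ℕP.<-cmp l k
... | tri< a _ _ = begin
      creatᵀ l (creatᵀ k g) b + creatᵀ k (creatᵀ l g) b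
        ≡⟨ cong₂ _+_ (creatᵀ-All< (creatᵀ k g) b pl) (creatᵀ-All< (creatᵀ l g) b pk) ⟩
      creatᵀ k g (l ∷ b) + creatᵀ l g (k ∷ b)
        ≡⟨ cong₂ _+_ (creatᵀ-< g b a) (trans (creatᵀ-> g b a) (cong -_ (creatᵀ-All< (λ x → g (k ∷ x)) b pl))) ⟩
      g (k ∷ l ∷ b) + - g (k ∷ l ∷ b)
        ≡⟨ +-inverseʳ (g (k ∷ l ∷ b)) ⟩
      0ℚ ∎ where open ≡-Reasoning
... | tri≈ _ refl _ = begin
      creatᵀ l (creatᵀ l g) b + creatᵀ l (creatᵀ l g) b
        ≡⟨ cong₂ _+_ (creatᵀ-All< (creatᵀ l g) b pl) (creatᵀ-All< (creatᵀ l g) b pk) ⟩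
      creatᵀ l g (l ∷ b) + creatᵀ l g (l ∷ b)
        ≡⟨ cong₂ _+_ (creatᵀ-self l g b) (creatᵀ-self l g b) ⟩
      0ℚ ∎ where open ≡-Reasoning
... | tri> _ _ a = begin
      creatᵀ l (creatᵀ k g) b + creatᵀ k (creatᵀ l g) b
        ≡⟨ cong₂ _+_ (creatᵀ-All< (creatᵀ k g) b pl) (creatᵀ-All< (creatᵀ l g) b pk) ⟩
      creatᵀ k g (l ∷ b) + creatᵀ l g (k ∷ b)
        ≡⟨ cong₂ _+_ (trans (creatᵀ-> g b a) (cong -_ (creatᵀ-All< (λ x → g (l ∷ x)) b pk))) (creatᵀ-< g b a) ⟩
      - g (l ∷ k ∷ b) + g (l ∷ k ∷ b)
        ≡⟨ +-inverseˡ (g (l ∷ k ∷ b)) ⟩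
      0ℚ ∎ where open ≡-Reasoning

creatᵀ-anticomm-<-self : ∀ {k n} g ns → n < k → creatᵀ n (creatᵀ k g) (n ∷ ns) + creatᵀ k (creatᵀ n g) (n ∷ ns) ≡ 0ℚ
creatᵀ-anticomm-<-self {k} {n} g ns a = begin
  creatᵀ n (creatᵀ k g) (n ∷ ns) + creatᵀ k (creatᵀ n g) (n ∷ ns)
    ≡⟨ cong₂ _+_ (creatᵀ-self n (creatᵀ k g) ns) (creatᵀ-< (creatᵀ n g) ns a) ⟩
  0ℚ + creatᵀ n g (k ∷ n ∷ ns)
    ≡⟨ cong (λ y → 0ℚ + y) (trans (creatᵀ-> g (n ∷ ns) a) (cong -_ (creatᵀ-self n (λ x → g (k ∷ x)) ns))) ⟩
  0ℚ ∎ where open ≡-Reasoning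

creatᵀ-anticomm-<-> : ∀ {k l n} g ns → n < k → l < n → creatᵀ l (creatᵀ k g) (n ∷ ns) + creatᵀ k (creatᵀ l g) (n ∷ ns) ≡ 0ℚ
creatᵀ-anticomm-<-> {k} {l} {n} g ns a c = begin
  creatᵀ l (creatᵀ k g) (n ∷ ns) + creatᵀ k (creatᵀ l g) (n ∷ ns)
    ≡⟨ cong₂ _+_ (trans (creatᵀ-> (creatᵀ k g) ns c) (cong -_ (pair-cong (creat l ns) (λ x → creatᵀ-< g x a))))
                 (trans (creatᵀ-< (creatᵀ l g) ns a) (trans (creatᵀ-> g (n ∷ ns) (ℕP.<-trans c a))
                   (cong -_ (creatᵀ-> (λ x → g (k ∷ x)) ns c)))) ⟩
  - X + - - X
    ≡⟨ solve 1 (λ x → :- x :+ :- :- x := con 0ℚ) refl X ⟩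
  0ℚ ∎ where
    open ≡-Reasoning
    X = creatᵀ l (λ x → g (k ∷ n ∷ x)) ns

creatᵀ-anticomm-self-> : ∀ {l n} g ns → l < n → creatᵀ l (creatᵀ n g) (n ∷ ns) + creatᵀ n (creatᵀ l g) (n ∷ ns) ≡ 0ℚ
creatᵀ-anticomm-self-> {l} {n} g ns c = begin
  creatᵀ l (creatᵀ n g) (n ∷ ns) + creatᵀ n (creatᵀ l g) (n ∷ ns)
    ≡⟨ cong₂ _+_ (trans (creatᵀ-> (creatᵀ n g) ns c)
                   (cong -_ (trans (pair-cong (creat l ns) (λ x → creatᵀ-self n g x)) (pair-0 (creat l ns)))))
                 (creatᵀ-self n (creatᵀ l g) ns) ⟩
  0ℚ ∎ where open ≡-Reasoning

creatᵀ-anticomm : ∀ k l g b → Decreasing b → creatᵀ l (creatᵀ k g) b + creatᵀ k (creatᵀ l g) b ≡ 0ℚ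
creatᵀ-anticomm k l g [] _ = creatᵀ-anticomm-All< k l g [] [] []
creatᵀ-anticomm k l g (n ∷ ns) (ps , sL) with ℕP.<-cmp n k | ℕP.<-cmp n l
... | tri< a _ _ | tri< c _ _ = creatᵀ-anticomm-All< k l g (n ∷ ns) (All<-∷ a ps) (All<-∷ c ps)
... | tri< a _ _ | tri≈ _ refl _ = creatᵀ-anticomm-<-self g ns a
... | tri< a _ _ | tri> _ _ c = creatᵀ-anticomm-<-> g ns a c
... | tri≈ _ refl _ | tri< c _ _ = x+y≡0⇒y+x≡0 (creatᵀ n (creatᵀ l g) (n ∷ ns)) (creatᵀ l (creatᵀ n g) (n ∷ ns)) (creatᵀ-anticomm-<-self g ns c)
... | tri≈ _ refl _ | tri≈ _ refl _ = cong₂ _+_ (creatᵀ-self n (creatᵀ n g) ns) (creatᵀ-self n (creatᵀ n g) ns)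
... | tri≈ _ refl _ | tri> _ _ c = creatᵀ-anticomm-self-> g ns c
... | tri> _ _ a | tri< c _ _ = x+y≡0⇒y+x≡0 (creatᵀ k (creatᵀ l g) (n ∷ ns)) (creatᵀ l (creatᵀ k g) (n ∷ ns)) (creatᵀ-anticomm-<-> g ns c a)
... | tri> _ _ a | tri≈ _ refl _ = x+y≡0⇒y+x≡0 (creatᵀ k (creatᵀ n g) (n ∷ ns)) (creatᵀ n (creatᵀ k g) (n ∷ ns)) (creatᵀ-anticomm-self-> g ns a)
... | tri> _ _ a | tri> _ _ c = begin
  creatᵀ l (creatᵀ k g) (n ∷ ns) + creatᵀ k (creatᵀ l g) (n ∷ ns)
    ≡⟨ cong₂ _+_ (trans (creatᵀ-> (creatᵀ k g) ns c) (cong -_ (trans (pair-cong (creat l ns) (λ x → creatᵀ-> g x a)) (pair-neg (creatᵀ k g') (creat l ns)))))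
                 (trans (creatᵀ-> (creatᵀ l g) ns a) (cong -_ (trans (pair-cong (creat k ns) (λ x → creatᵀ-> g x c)) (pair-neg (creatᵀ l g') (creat k ns))))) ⟩
  - - creatᵀ l (creatᵀ k g') ns + - - creatᵀ k (creatᵀ l g') ns
    ≡⟨ neg-involutive-+ (creatᵀ l (creatᵀ k g') ns) (creatᵀ k (creatᵀ l g') ns) ⟩
  creatᵀ l (creatᵀ k g') ns + creatᵀ k (creatᵀ l g') ns
    ≡⟨ creatᵀ-anticomm k l g' ns sL ⟩
  0ℚ ∎ where
    open ≡-Reasoning
    g' = λ x → g (n ∷ x)

act0ᵀ-creatᵀ-anticomm : ∀ k g b → Decreasing b → act0ᵀ (creatᵀ (suc k) g) b + creatᵀ (suc k) (act0ᵀ g) b ≡ 0ℚ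
act0ᵀ-creatᵀ-anticomm k g [] _ = begin
  act0ᵀ (creatᵀ (suc k) g) [] + creatᵀ (suc k) (act0ᵀ g) []
    ≡⟨ cong₂ _+_ (trans (act0ᵀ-[] (creatᵀ (suc k) g)) (creatᵀ-< g [] (s≤s z≤n)))
                 (trans (creatᵀ-[] (suc k) (act0ᵀ g)) (trans (act0ᵀ-suc g k []) (cong -_ (act0ᵀ-[] (λ x → g (suc k ∷ x)))))) ⟩
  g (suc k ∷ 0 ∷ []) + - g (suc k ∷ 0 ∷ [])
    ≡⟨ +-inverseʳ (g (suc k ∷ 0 ∷ [])) ⟩
  0ℚ ∎ where open ≡-Reasoning
act0ᵀ-creatᵀ-anticomm k g (zero ∷ ns) (ps , _) rewrite All<0⇒[] ps = begin
  act0ᵀ (creatᵀ (suc k) g) (0 ∷ []) + creatᵀ (suc k) (act0ᵀ g) (0 ∷ [])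
    ≡⟨ cong₂ _+_ (trans (act0ᵀ-0 (creatᵀ (suc k) g) []) (creatᵀ-[] (suc k) g))
                 (trans (creatᵀ-< (act0ᵀ g) [] (s≤s z≤n)) (trans (act0ᵀ-suc g k (0 ∷ [])) (cong -_ (act0ᵀ-0 (λ x → g (suc k ∷ x)) [])))) ⟩
  g (suc k ∷ []) + - g (suc k ∷ [])
    ≡⟨ +-inverseʳ (g (suc k ∷ [])) ⟩
  0ℚ ∎ where open ≡-Reasoning
act0ᵀ-creatᵀ-anticomm k g (suc n ∷ ns) (ps , sL) with ℕP.<-cmp (suc n) (suc k)
... | tri< a _ _ = begin
  act0ᵀ (creatᵀ (suc k) g) (suc n ∷ ns) + creatᵀ (suc k) (act0ᵀ g) (suc n ∷ ns)
    ≡⟨ cong₂ _+_ (trans (act0ᵀ-suc (creatᵀ (suc k) g) n ns) (cong -_ (pair-cong (act0 ns) (λ x → creatᵀ-< g x a))))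
                 (trans (creatᵀ-< (act0ᵀ g) ns a) (trans (act0ᵀ-suc g k (suc n ∷ ns)) (cong -_ (act0ᵀ-suc (λ x → g (suc k ∷ x)) n ns)))) ⟩
  - X + - - X
    ≡⟨ neg-+-negneg≡0 X ⟩
  0ℚ ∎ where
    open ≡-Reasoning
    X = act0ᵀ (λ x → g (suc k ∷ suc n ∷ x)) ns
... | tri≈ _ refl _ = begin
  act0ᵀ (creatᵀ (suc n) g) (suc n ∷ ns) + creatᵀ (suc n) (act0ᵀ g) (suc n ∷ ns)
    ≡⟨ cong₂ _+_ (trans (act0ᵀ-suc (creatᵀ (suc n) g) n ns) (cong -_ (trans (pair-cong (act0 ns) (λ x → creatᵀ-self (suc n) g x)) (pair-0 (act0 ns)))))
                 (creatᵀ-self (suc n) (act0ᵀ g) ns) ⟩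
  0ℚ ∎ where open ≡-Reasoning
... | tri> _ _ c = begin
  act0ᵀ (creatᵀ (suc k) g) (suc n ∷ ns) + creatᵀ (suc k) (act0ᵀ g) (suc n ∷ ns)
    ≡⟨ cong₂ _+_ (trans (act0ᵀ-suc (creatᵀ (suc k) g) n ns) (cong -_ (pair-cong-neg act0 (λ x → creatᵀ (suc k) g (suc n ∷ x)) (creatᵀ (suc k) g') ns (λ x → creatᵀ-> g x c))))
                 (trans (creatᵀ-> (act0ᵀ g) ns c) (cong -_ (pair-cong-neg (creat (suc k)) (λ x → act0ᵀ g (suc n ∷ x)) (act0ᵀ g') ns (λ x → act0ᵀ-suc g n x)))) ⟩
  - - act0ᵀ (creatᵀ (suc k) g') ns + - - creatᵀ (suc k) (act0ᵀ g') ns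
    ≡⟨ neg-involutive-+ (act0ᵀ (creatᵀ (suc k) g') ns) (creatᵀ (suc k) (act0ᵀ g') ns) ⟩
  act0ᵀ (creatᵀ (suc k) g') ns + creatᵀ (suc k) (act0ᵀ g') ns
    ≡⟨ act0ᵀ-creatᵀ-anticomm k g' ns sL ⟩
  0ℚ ∎ where
    open ≡-Reasoning
    g' = λ x → g (suc n ∷ x)

act0ᵀ-involutive : ∀ g b → Decreasing b → act0ᵀ (act0ᵀ g) b ≡ g b
act0ᵀ-involutive g [] _ = trans (act0ᵀ-[] (act0ᵀ g)) (act0ᵀ-0 g [])
act0ᵀ-involutive g (zero ∷ ns) (ps , _) rewrite All<0⇒[] ps = trans (act0ᵀ-0 (act0ᵀ g) []) (act0ᵀ-[] g)
act0ᵀ-involutive g (suc n ∷ ns) (ps , sL) = begin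
  act0ᵀ (act0ᵀ g) (suc n ∷ ns)
    ≡⟨ trans (act0ᵀ-suc (act0ᵀ g) n ns) (cong -_ (pair-cong-neg act0 (λ x → act0ᵀ g (suc n ∷ x)) (act0ᵀ g') ns (λ x → act0ᵀ-suc g n x))) ⟩
  - - act0ᵀ (act0ᵀ g') ns
    ≡⟨ neg-involutive (act0ᵀ (act0ᵀ g') ns) ⟩
  act0ᵀ (act0ᵀ g') ns
    ≡⟨ act0ᵀ-involutive g' ns sL ⟩
  g (suc n ∷ ns) ∎ where
    open ≡-Reasoning
    g' = λ x → g (suc n ∷ x)

annihᵀ-creatᵀ-anticomm-self : ∀ k g b → Decreasing b → annihᵀ k (creatᵀ k g) b + creatᵀ k (annihᵀ k g) b ≡ twoSign k * g b
annihᵀ-creatᵀ-anticomm-self k g [] _ = trans (cong (λ y → 0ℚ + y) (trans (creatᵀ-[] k (annihᵀ k g)) (annihᵀ-self {k} g [] []))) (+-identityˡ _)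
annihᵀ-creatᵀ-anticomm-self k g (n ∷ ns) (ps , sL) with ℕP.<-cmp n k
... | tri< a _ _ = trans (cong₂ _+_ (annihᵀ-absent (creatᵀ k g) (n ∷ ns) (All<⇒≢ (All<-∷ a ps)))
                                    (trans (creatᵀ-< (annihᵀ k g) ns a) (annihᵀ-self g (n ∷ ns) (All<-∷ a ps))))
                         (+-identityˡ _)
... | tri≈ _ refl _ = trans (cong₂ _+_ (trans (annihᵀ-self (creatᵀ n g) ns ps) (cong (λ y → twoSign n * y) (creatᵀ-All< g ns ps)))
                                       (creatᵀ-self n (annihᵀ n g) ns))
                            (+-identityʳ _)
... | tri> _ _ c = begin
  annihᵀ k (creatᵀ k g) (n ∷ ns) + creatᵀ k (annihᵀ k g) (n ∷ ns)
    ≡⟨ cong₂ _+_ (trans (annihᵀ-≢ (creatᵀ k g) ns nk) (cong -_ (pair-cong-neg (annih k) (λ x → creatᵀ k g (n ∷ x)) (creatᵀ k g') ns (λ x → creatᵀ-> g x c))))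
                 (trans (creatᵀ-> (annihᵀ k g) ns c) (cong -_ (pair-cong-neg (creat k) (λ x → annihᵀ k g (n ∷ x)) (annihᵀ k g') ns (λ x → annihᵀ-≢ g x nk)))) ⟩
  - - annihᵀ k (creatᵀ k g') ns + - - creatᵀ k (annihᵀ k g') ns
    ≡⟨ neg-involutive-+ (annihᵀ k (creatᵀ k g') ns) (creatᵀ k (annihᵀ k g') ns) ⟩
  annihᵀ k (creatᵀ k g') ns + creatᵀ k (annihᵀ k g') ns
    ≡⟨ annihᵀ-creatᵀ-anticomm-self k g' ns sL ⟩
  twoSign k * g (n ∷ ns) ∎ where
    open ≡-Reasoning
    g' = λ x → g (n ∷ x)
    nk : ¬ (n ≡ k)
    nk e = ℕP.<⇒≢ c (sym e)

annihᵀ-creatᵀ-anticomm-≢ : ∀ k l g b → ¬ (k ≡ l) → Decreasing b → annihᵀ l (creatᵀ k g) b + creatᵀ k (annihᵀ l g) b ≡ 0ℚ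
annihᵀ-creatᵀ-anticomm-≢ k l g [] kl _ = cong (λ y → 0ℚ + y) (trans (creatᵀ-[] k (annihᵀ l g)) (annihᵀ-≢ g [] kl))
annihᵀ-creatᵀ-anticomm-≢ k l g (n ∷ ns) kl (ps , sL) with ℕP.<-cmp n k | n ℕP.≟ l
... | tri< a _ _ | yes refl = begin
  annihᵀ n (creatᵀ k g) (n ∷ ns) + creatᵀ k (annihᵀ n g) (n ∷ ns)
    ≡⟨ cong₂ _+_ (trans (annihᵀ-self (creatᵀ k g) ns ps) (cong (λ y → twoSign n * y) (creatᵀ-All< g ns (All.map (λ q → ℕP.<-trans q a) ps))))
                 (trans (creatᵀ-< (annihᵀ n g) ns a) (trans (annihᵀ-≢ g (n ∷ ns) kl) (cong -_ (annihᵀ-self (λ x → g (k ∷ x)) ns ps)))) ⟩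
  twoSign n * g (k ∷ ns) + - (twoSign n * g (k ∷ ns))
    ≡⟨ +-inverseʳ (twoSign n * g (k ∷ ns)) ⟩
  0ℚ ∎ where open ≡-Reasoning
... | tri< a _ _ | no nl = begin
  annihᵀ l (creatᵀ k g) (n ∷ ns) + creatᵀ k (annihᵀ l g) (n ∷ ns)
    ≡⟨ cong₂ _+_ (trans (annihᵀ-≢ (creatᵀ k g) ns nl) (cong -_ (pair-cong (annih l ns) (λ x → creatᵀ-< g x a))))
                 (trans (creatᵀ-< (annihᵀ l g) ns a) (trans (annihᵀ-≢ g (n ∷ ns) kl) (cong -_ (annihᵀ-≢ (λ x → g (k ∷ x)) ns nl)))) ⟩
  - X + - - X
    ≡⟨ neg-+-negneg≡0 X ⟩
  0ℚ ∎ where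
    open ≡-Reasoning
    X = annihᵀ l (λ x → g (k ∷ n ∷ x)) ns
... | tri≈ _ refl _ | _ = begin
  annihᵀ l (creatᵀ n g) (n ∷ ns) + creatᵀ n (annihᵀ l g) (n ∷ ns)
    ≡⟨ cong₂ _+_ (trans (annihᵀ-≢ (creatᵀ n g) ns kl) (cong -_ (trans (pair-cong (annih l ns) (λ x → creatᵀ-self n g x)) (pair-0 (annih l ns)))))
                 (creatᵀ-self n (annihᵀ l g) ns) ⟩
  0ℚ ∎ where open ≡-Reasoning
... | tri> _ _ c | yes refl = begin
  annihᵀ n (creatᵀ k g) (n ∷ ns) + creatᵀ k (annihᵀ n g) (n ∷ ns)
    ≡⟨ cong₂ _+_ (annihᵀ-self (creatᵀ k g) ns ps)
                 (trans (creatᵀ-> (annihᵀ n g) ns c)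
                   (cong -_ (trans (pair-cong-on (creat k ns) (creat-all ns ps c) (λ x p → annihᵀ-self g x p))
                                   (pair-* (twoSign n) g (creat k ns))))) ⟩
  twoSign n * creatᵀ k g ns + - (twoSign n * creatᵀ k g ns)
    ≡⟨ +-inverseʳ (twoSign n * creatᵀ k g ns) ⟩
  0ℚ ∎ where open ≡-Reasoning
... | tri> _ _ c | no nl = begin
  annihᵀ l (creatᵀ k g) (n ∷ ns) + creatᵀ k (annihᵀ l g) (n ∷ ns)
    ≡⟨ cong₂ _+_ (trans (annihᵀ-≢ (creatᵀ k g) ns nl) (cong -_ (pair-cong-neg (annih l) (λ x → creatᵀ k g (n ∷ x)) (creatᵀ k g') ns (λ x → creatᵀ-> g x c))))
                 (trans (creatᵀ-> (annihᵀ l g) ns c) (cong -_ (pair-cong-neg (creat k) (λ x → annihᵀ l g (n ∷ x)) (annihᵀ l g') ns (λ x → annihᵀ-≢ g x nl)))) ⟩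
  - - annihᵀ l (creatᵀ k g') ns + - - creatᵀ k (annihᵀ l g') ns
    ≡⟨ neg-involutive-+ (annihᵀ l (creatᵀ k g') ns) (creatᵀ k (annihᵀ l g') ns) ⟩
  annihᵀ l (creatᵀ k g') ns + creatᵀ k (annihᵀ l g') ns
    ≡⟨ annihᵀ-creatᵀ-anticomm-≢ k l g' ns kl sL ⟩
  0ℚ ∎ where
    open ≡-Reasoning
    g' = λ x → g (n ∷ x)

annihᵀ-act0ᵀ-anticomm : ∀ l g b → Decreasing b → annihᵀ (suc l) (act0ᵀ g) b + act0ᵀ (annihᵀ (suc l) g) b ≡ 0ℚ
annihᵀ-act0ᵀ-anticomm l g [] _ = cong (λ y → 0ℚ + y) (trans (act0ᵀ-[] (annihᵀ (suc l) g)) (annihᵀ-≢ {suc l} {0} g [] (λ ())))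
annihᵀ-act0ᵀ-anticomm l g (zero ∷ ns) (ps , _) rewrite All<0⇒[] ps =
  cong₂ _+_ (annihᵀ-≢ {suc l} {0} (act0ᵀ g) [] (λ ())) (act0ᵀ-0 (annihᵀ (suc l) g) [])
annihᵀ-act0ᵀ-anticomm l g (suc n ∷ ns) (ps , sL) with suc n ℕP.≟ suc l
... | yes refl = begin
  annihᵀ (suc n) (act0ᵀ g) (suc n ∷ ns) + act0ᵀ (annihᵀ (suc n) g) (suc n ∷ ns)
    ≡⟨ cong₂ _+_ (annihᵀ-self (act0ᵀ g) ns ps)
                 (trans (act0ᵀ-suc (annihᵀ (suc n) g) n ns)
                   (cong -_ (trans (pair-cong-on (act0 ns) (act0-all ns ps (s≤s z≤n)) (λ x p → annihᵀ-self g x p))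
                                   (pair-* (twoSign (suc n)) g (act0 ns))))) ⟩
  twoSign (suc n) * act0ᵀ g ns + - (twoSign (suc n) * act0ᵀ g ns)
    ≡⟨ +-inverseʳ (twoSign (suc n) * act0ᵀ g ns) ⟩
  0ℚ ∎ where open ≡-Reasoning
... | no ne = begin
  annihᵀ (suc l) (act0ᵀ g) (suc n ∷ ns) + act0ᵀ (annihᵀ (suc l) g) (suc n ∷ ns)
    ≡⟨ cong₂ _+_ (trans (annihᵀ-≢ (act0ᵀ g) ns ne) (cong -_ (pair-cong-neg (annih (suc l)) (λ x → act0ᵀ g (suc n ∷ x)) (act0ᵀ g') ns (λ x → act0ᵀ-suc g n x))))
                 (trans (act0ᵀ-suc (annihᵀ (suc l) g) n ns) (cong -_ (pair-cong-neg act0 (λ x → annihᵀ (suc l) g (suc n ∷ x)) (annihᵀ (suc l) g') ns (λ x → annihᵀ-≢ g x ne)))) ⟩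
  - - annihᵀ (suc l) (act0ᵀ g') ns + - - act0ᵀ (annihᵀ (suc l) g') ns
    ≡⟨ neg-involutive-+ (annihᵀ (suc l) (act0ᵀ g') ns) (act0ᵀ (annihᵀ (suc l) g') ns) ⟩
  annihᵀ (suc l) (act0ᵀ g') ns + act0ᵀ (annihᵀ (suc l) g') ns
    ≡⟨ annihᵀ-act0ᵀ-anticomm l g' ns sL ⟩
  0ℚ ∎ where
    open ≡-Reasoning
    g' = λ x → g (suc n ∷ x)

annihᵀ-anticomm : ∀ k l g b → Decreasing b → annihᵀ l (annihᵀ k g) b + annihᵀ k (annihᵀ l g) b ≡ 0ℚ
annihᵀ-anticomm k l g [] _ = refl
annihᵀ-anticomm k l g (n ∷ ns) (ps , sL) with n ℕP.≟ k | n ℕP.≟ l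
... | yes refl | yes refl =
  cong₂ _+_ e e where
    e : annihᵀ n (annihᵀ n g) (n ∷ ns) ≡ 0ℚ
    e = trans (annihᵀ-self (annihᵀ n g) ns ps) (trans (cong (λ y → twoSign n * y) (annihᵀ-absent g ns (All<⇒≢ ps))) (*-zeroʳ (twoSign n)))
... | yes refl | no nl = begin
  annihᵀ l (annihᵀ n g) (n ∷ ns) + annihᵀ n (annihᵀ l g) (n ∷ ns)
    ≡⟨ cong₂ _+_ (trans (annihᵀ-≢ (annihᵀ n g) ns nl)
                   (cong -_ (trans (pair-cong-on (annih l ns) (annih-all l ns ps) (λ x p → annihᵀ-self g x p))
                                   (pair-* (twoSign n) g (annih l ns)))))
                 (annihᵀ-self (annihᵀ l g) ns ps) ⟩
  - (twoSign n * annihᵀ l g ns) + twoSign n * annihᵀ l g ns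
    ≡⟨ +-inverseˡ (twoSign n * annihᵀ l g ns) ⟩
  0ℚ ∎ where open ≡-Reasoning
... | no nk | yes refl = begin
  annihᵀ n (annihᵀ k g) (n ∷ ns) + annihᵀ k (annihᵀ n g) (n ∷ ns)
    ≡⟨ cong₂ _+_ (annihᵀ-self (annihᵀ k g) ns ps)
                 (trans (annihᵀ-≢ (annihᵀ n g) ns nk)
                   (cong -_ (trans (pair-cong-on (annih k ns) (annih-all k ns ps) (λ x p → annihᵀ-self g x p))
                                   (pair-* (twoSign n) g (annih k ns))))) ⟩
  twoSign n * annihᵀ k g ns + - (twoSign n * annihᵀ k g ns)
    ≡⟨ +-inverseʳ (twoSign n * annihᵀ k g ns) ⟩
  0ℚ ∎ where open ≡-Reasoning
... | no nk | no nl = begin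
  annihᵀ l (annihᵀ k g) (n ∷ ns) + annihᵀ k (annihᵀ l g) (n ∷ ns)
    ≡⟨ cong₂ _+_ (trans (annihᵀ-≢ (annihᵀ k g) ns nl) (cong -_ (pair-cong-neg (annih l) (λ x → annihᵀ k g (n ∷ x)) (annihᵀ k g') ns (λ x → annihᵀ-≢ g x nk))))
                 (trans (annihᵀ-≢ (annihᵀ l g) ns nk) (cong -_ (pair-cong-neg (annih k) (λ x → annihᵀ l g (n ∷ x)) (annihᵀ l g') ns (λ x → annihᵀ-≢ g x nl)))) ⟩
  - - annihᵀ l (annihᵀ k g') ns + - - annihᵀ k (annihᵀ l g') ns
    ≡⟨ neg-involutive-+ (annihᵀ l (annihᵀ k g') ns) (annihᵀ k (annihᵀ l g') ns) ⟩
  annihᵀ l (annihᵀ k g') ns + annihᵀ k (annihᵀ l g') ns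
    ≡⟨ annihᵀ-anticomm k l g' ns sL ⟩
  0ℚ ∎ where
    open ≡-Reasoning
    g' = λ x → g (n ∷ x)

φᵀ : ℤ → (Basis → ℚ) → Basis → ℚ
φᵀ n g b = pair g (φB n b)

pair-φ : ∀ g n v → pair g (φ n v) ≡ pair (φᵀ n g) v
pair-φ g n v = pair-concatMap-scale g _ (φB n) (λ a b → refl) v

anticommutator : ℤ → ℤ → ℚ
anticommutator (+ zero) (+ zero) = twoSign 0
anticommutator (+ suc k) -[1+ l ] = if k ≡ᵇ l then twoSign (suc k) else 0ℚ
anticommutator -[1+ l ] (+ suc k) = if k ≡ᵇ l then twoSign (suc l) else 0ℚ
anticommutator _ _ = 0ℚ

φᵀ-anticomm : ∀ m n g b → Decreasing b → φᵀ n (φᵀ m g) b + φᵀ m (φᵀ n g) b ≡ anticommutator m n * g b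
φᵀ-anticomm (+ zero) (+ zero) g b s =
  trans (cong₂ _+_ (act0ᵀ-involutive g b s) (act0ᵀ-involutive g b s)) (solve 1 (λ x → x :+ x := (con 1ℚ :+ con 1ℚ) :* x) refl (g b))
φᵀ-anticomm (+ zero) (+ suc k) g b s =
  trans (x+y≡0⇒y+x≡0 (act0ᵀ (creatᵀ (suc k) g) b) (creatᵀ (suc k) (act0ᵀ g) b) (act0ᵀ-creatᵀ-anticomm k g b s))
        (sym (*-zeroˡ (g b)))
φᵀ-anticomm (+ zero) -[1+ l ] g b s = trans (annihᵀ-act0ᵀ-anticomm l g b s) (sym (*-zeroˡ (g b)))
φᵀ-anticomm (+ suc k) (+ zero) g b s = trans (act0ᵀ-creatᵀ-anticomm k g b s) (sym (*-zeroˡ (g b)))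
φᵀ-anticomm (+ suc k) (+ suc l) g b s = trans (creatᵀ-anticomm (suc k) (suc l) g b s) (sym (*-zeroˡ (g b)))
φᵀ-anticomm (+ suc k) -[1+ l ] g b s with k ℕP.≟ l
... | yes refl rewrite ≡ᵇ-refl k = annihᵀ-creatᵀ-anticomm-self (suc k) g b s
... | no ne rewrite ≢⇒≡ᵇ≡false ne = trans (annihᵀ-creatᵀ-anticomm-≢ (suc k) (suc l) g b (λ e → ne (ℕP.suc-injective e)) s) (sym (*-zeroˡ (g b)))
φᵀ-anticomm -[1+ l ] (+ zero) g b s =
  trans (x+y≡0⇒y+x≡0 (annihᵀ (suc l) (act0ᵀ g) b) (act0ᵀ (annihᵀ (suc l) g) b) (annihᵀ-act0ᵀ-anticomm l g b s))
        (sym (*-zeroˡ (g b)))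
φᵀ-anticomm -[1+ l ] (+ suc k) g b s with k ℕP.≟ l
... | yes refl rewrite ≡ᵇ-refl k =
  trans (+-comm (creatᵀ (suc k) (annihᵀ (suc k) g) b) (annihᵀ (suc k) (creatᵀ (suc k) g) b)) (annihᵀ-creatᵀ-anticomm-self (suc k) g b s)
... | no ne rewrite ≢⇒≡ᵇ≡false ne =
  trans (x+y≡0⇒y+x≡0 (annihᵀ (suc l) (creatᵀ (suc k) g) b) (creatᵀ (suc k) (annihᵀ (suc l) g) b)
                      (annihᵀ-creatᵀ-anticomm-≢ (suc k) (suc l) g b (λ e → ne (ℕP.suc-injective e)) s))
        (sym (*-zeroˡ (g b)))
φᵀ-anticomm -[1+ k ] -[1+ l ] g b s = trans (annihᵀ-anticomm (suc k) (suc l) g b s) (sym (*-zeroˡ (g b)))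

anticommutator-neg : ∀ a → anticommutator a (ℤ.- a) ≡ ℕtoℚ 2 * sgnℤ a
anticommutator-neg (+ zero) = refl
anticommutator-neg (+ suc k) rewrite ≡ᵇ-refl k = refl
anticommutator-neg -[1+ k ] rewrite ≡ᵇ-refl k = refl

anticommutator-≢ : ∀ a b → ¬ (a ℤ.+ b ≡ + 0) → anticommutator a b ≡ 0ℚ
anticommutator-≢ (+ zero) (+ zero) ne = ⊥-elim (ne refl)
anticommutator-≢ (+ zero) (+ suc k) ne = refl
anticommutator-≢ (+ zero) -[1+ k ] ne = refl
anticommutator-≢ (+ suc k) (+ zero) ne = refl
anticommutator-≢ (+ suc k) (+ suc l) ne = refl
anticommutator-≢ (+ suc k) -[1+ l ] ne with k ℕP.≟ l
... | yes refl = ⊥-elim (ne (ℤP.+-inverseʳ (+ suc k)))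
... | no kl rewrite ≢⇒≡ᵇ≡false kl = refl
anticommutator-≢ -[1+ l ] (+ zero) ne = refl
anticommutator-≢ -[1+ l ] (+ suc k) ne with k ℕP.≟ l
... | yes refl = ⊥-elim (ne (ℤP.+-inverseˡ (+ suc k)))
... | no kl rewrite ≢⇒≡ᵇ≡false kl = refl
anticommutator-≢ -[1+ k ] -[1+ l ] ne = refl

creat-decreasing : ∀ {k} ns → Decreasing ns → AllTerms Decreasing (creat k ns)
creat-decreasing [] _ = ([] , tt) ∷ []
creat-decreasing {k} (n ∷ ns) (ps , sL) with ℕP.<-cmp n k
... | tri< a _ _ rewrite creat-< ns a = (All<-∷ a ps , (ps , sL)) ∷ []
... | tri≈ _ refl _ rewrite creat-self n ns = []
... | tri> _ _ c rewrite creat-> ns c =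
  AllTerms-negPrefix n (creat k ns) (AllTerms-zip (creat k ns) (creat-all ns ps c) (creat-decreasing ns sL))

annih-decreasing : ∀ k ns → Decreasing ns → AllTerms Decreasing (annih k ns)
annih-decreasing k [] _ = []
annih-decreasing k (n ∷ ns) (ps , sL) with n ≡ᵇ k
... | true = sL ∷ AllTerms-negPrefix n (annih k ns) (AllTerms-zip (annih k ns) (annih-all k ns ps) (annih-decreasing k ns sL))
... | false = AllTerms-negPrefix n (annih k ns) (AllTerms-zip (annih k ns) (annih-all k ns ps) (annih-decreasing k ns sL))

act0-decreasing : ∀ ns → Decreasing ns → AllTerms Decreasing (act0 ns)
act0-decreasing [] _ = ([] , tt) ∷ []
act0-decreasing (zero ∷ ns) (ps , sL) = sL ∷ []
act0-decreasing (suc n ∷ ns) (ps , sL) =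
  AllTerms-negPrefix (suc n) (act0 ns) (AllTerms-zip (act0 ns) (act0-all ns ps (s≤s z≤n)) (act0-decreasing ns sL))

φB-decreasing : ∀ n b → Decreasing b → AllTerms Decreasing (φB n b)
φB-decreasing (+ zero) b s = act0-decreasing b s
φB-decreasing (+ suc k) b s = creat-decreasing b s
φB-decreasing -[1+ k ] b s = annih-decreasing (suc k) b s

creat-weight : ∀ k ns → AllTerms (λ x → sumℕ x ≡ k ℕ.+ sumℕ ns) (creat k ns)
creat-weight k [] = refl ∷ []
creat-weight k (n ∷ ns) with ℕP.<-cmp n k
... | tri< a _ _ rewrite creat-< ns a = refl ∷ []
... | tri≈ _ refl _ rewrite creat-self n ns = []
... | tri> _ _ c rewrite creat-> ns c =
  AllTerms-negPrefix n (creat k ns) (AllTerms-map (λ x e → trans (cong (n ℕ.+_) e) (ℕ+-exchange n k (sumℕ ns))) (creat k ns) (creat-weight k ns))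

annih-weight : ∀ k ns → AllTerms (λ x → k ℕ.+ sumℕ x ≡ sumℕ ns) (annih k ns)
annih-weight k [] = []
annih-weight k (n ∷ ns) with n ℕP.≟ k
... | yes refl rewrite ≡ᵇ-refl n =
  refl ∷ AllTerms-negPrefix n (annih n ns)
           (AllTerms-map (λ x e → trans (ℕ+-exchange n n (sumℕ x)) (cong (n ℕ.+_) e)) (annih n ns) (annih-weight n ns))
... | no ne rewrite ≢⇒≡ᵇ≡false ne =
  AllTerms-negPrefix n (annih k ns)
    (AllTerms-map (λ x e → trans (ℕ+-exchange k n (sumℕ x)) (cong (n ℕ.+_) e)) (annih k ns) (annih-weight k ns))

act0-weight : ∀ ns → AllTerms (λ x → sumℕ x ≡ sumℕ ns) (act0 ns)
act0-weight [] = refl ∷ []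
act0-weight (zero ∷ ns) = refl ∷ []
act0-weight (suc n ∷ ns) = AllTerms-negPrefix (suc n) (act0 ns) (AllTerms-map (λ x e → cong (suc n ℕ.+_) e) (act0 ns) (act0-weight ns))

HasWeight : ℤ → Basis → Set
HasWeight d x = + sumℕ x ≡ d

φB-weight : ∀ n b → AllTerms (HasWeight (+ sumℕ b ℤ.+ n)) (φB n b)
φB-weight (+ zero) b = AllTerms-map (λ x e → trans (cong +_ e) (sym (ℤP.+-identityʳ _))) (act0 b) (act0-weight b)
φB-weight (+ suc k) b =
  AllTerms-map (λ x e → trans (cong +_ e) (trans (ℤP.pos-+ (suc k) (sumℕ b)) (ℤP.+-comm (+ suc k) (+ sumℕ b))))
               (creat (suc k) b) (creat-weight (suc k) b)
φB-weight -[1+ k ] b = AllTerms-map (λ x e → sym (trans (cong (λ z → + z ℤ.+ -[1+ k ]) (sym e))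
                                          (trans (cong (ℤ._+ -[1+ k ]) (ℤP.pos-+ (suc k) (sumℕ x))) ([x+y]-x≡y (+ suc k) (+ sumℕ x)))))
                             (annih (suc k) b) (annih-weight (suc k) b)

AllTerms-φ : ∀ {P Q : Basis → Set} n v → AllTerms Q v → (∀ b → Q b → AllTerms P (φB n b)) → AllTerms P (φ n v)
AllTerms-φ n [] [] f = []
AllTerms-φ n ((a , b) ∷ v) (q ∷ qs) f = AllTerms-++ (scale a (φB n b)) (φ n v) (AllTerms-scale a (φB n b) (f b q)) (AllTerms-φ n v qs f)

AllTerms-concatMap : ∀ {A : Set} {P : Basis → Set} (f : A → FVec) xs → (∀ x → AllTerms P (f x)) → AllTerms P (concatMap f xs)
AllTerms-concatMap f [] h = []
AllTerms-concatMap f (x ∷ xs) h = AllTerms-++ (f x) (concatMap f xs) (h x) (AllTerms-concatMap f xs h)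

bNegB-weight : ∀ j b → AllTerms (HasWeight (+ sumℕ b ℤ.+ + j)) (bNegB j b)
bNegB-weight j b = AllTerms-scale (½ * ½) _
  (AllTerms-concatMap (λ t → scale (sgnℤ (+ t ℤ.- + M)) (φ (+ j ℤ.- (+ t ℤ.- + M)) (φB (+ t ℤ.- + M) b))) (upTo (suc (j ℕ.+ M ℕ.+ M)))
    (λ t → AllTerms-scale (sgnℤ (+ t ℤ.- + M)) _ (AllTerms-φ (+ j ℤ.- (+ t ℤ.- + M)) (φB (+ t ℤ.- + M) b) (φB-weight (+ t ℤ.- + M) b)
             (λ x e → AllTerms-map (λ x' e' → trans e' (trans (cong (ℤ._+ (+ j ℤ.- (+ t ℤ.- + M))) e) (shift (+ M) (+ t ℤ.- + M) (+ j))))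
                        (φB (+ j ℤ.- (+ t ℤ.- + M)) x) (φB-weight (+ j ℤ.- (+ t ℤ.- + M)) x)))))
  where
  M = sumℕ b
  shift : ∀ (s i j : ℤ) → (s ℤ.+ i) ℤ.+ (j ℤ.- i) ≡ s ℤ.+ j
  shift = ℤ-solve-∀

bNegᵀ : ℕ → (Basis → ℚ) → Basis → ℚ
bNegᵀ j g b = pair g (bNegB j b)

pair-bNeg : ∀ g j v → pair g (bNeg j v) ≡ pair (bNegᵀ j g) v
pair-bNeg g j v = pair-concatMap-scale g _ (bNegB j) (λ a b → refl) v

bNegᵀ-vac : ∀ j b → bNegᵀ (suc j) vacᵀ b ≡ 0ℚ
bNegᵀ-vac j b = trans (pair-cong-on (bNegB (suc j) b) (bNegB-weight (suc j) b) f) (pair-0 (bNegB (suc j) b))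
  where
    f : ∀ x → HasWeight (+ sumℕ b ℤ.+ + suc j) x → vacᵀ x ≡ 0ℚ
    f [] e with trans (trans e (sym (ℤP.pos-+ (sumℕ b) (suc j)))) (cong +_ (ℕP.+-suc (sumℕ b) j))
    ... | ()
    f (_ ∷ _) e = refl

windowSum : ℕ → ℕ → (ℤ → ℚ) → ℚ
windowSum j N F = ∑ (suc (j ℕ.+ N ℕ.+ N)) (λ t → F (+ t ℤ.- + N))

record WindowIndex (j N : ℕ) (i : ℤ) : Set where
  constructor windowIndex
  field
    t       : ℕ
    t-N≡i   : + t ℤ.- + N ≡ i
    t<      : t < suc (j ℕ.+ N ℕ.+ N)

windowSum-single : ∀ {j N i₀} F → WindowIndex j N i₀ → (∀ i → ¬ (i ≡ i₀) → F i ≡ 0ℚ) → windowSum j N F ≡ F i₀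
windowSum-single {N = N} F (windowIndex t₀ t₀-N≡i₀ t₀<) F≡0 =
  trans (∑-single _ t₀ (λ t → F (+ t ℤ.- + N)) t₀<
                  (λ t _ t≢t₀ → F≡0 (+ t ℤ.- + N) (λ e → t≢t₀ (+t-+N-injective N (trans e (sym t₀-N≡i₀))))))
        (cong F t₀-N≡i₀)

windowIndex-+ : ∀ j M y → WindowIndex j (M ℕ.+ ℤ.∣ y ∣) (y ℤ.+ + j)
windowIndex-+ j M (+ a) = windowIndex ((a ℕ.+ j) ℕ.+ (M ℕ.+ a))
  (trans (a≡c+b⇒+a-+b≡+c _ (M ℕ.+ a) (a ℕ.+ j) refl) (ℤP.pos-+ a j)) (s≤s (a≡b+c⇒b≤a (split a j M)))
  where
  split : ∀ a j M → j ℕ.+ (M ℕ.+ a) ℕ.+ (M ℕ.+ a) ≡ ((a ℕ.+ j) ℕ.+ (M ℕ.+ a)) ℕ.+ M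
  split = ℕ-solve-∀
windowIndex-+ j M -[1+ a ] = windowIndex (j ℕ.+ M) (index a) (s≤s (a≡b+c⇒b≤a (split a j M)))
  where
  index : ∀ a → + (j ℕ.+ M) ℤ.- + (M ℕ.+ suc a) ≡ -[1+ a ] ℤ.+ + j
  index a rewrite ℤP.pos-+ j M | ℤP.pos-+ M (suc a) = identity (+ j) (+ M) (+ suc a)
    where
    identity : ∀ (j M s : ℤ) → (j ℤ.+ M) ℤ.- (M ℤ.+ s) ≡ ℤ.- s ℤ.+ j
    identity = ℤ-solve-∀
  split : ∀ a j M → j ℕ.+ (M ℕ.+ suc a) ℕ.+ (M ℕ.+ suc a) ≡ (j ℕ.+ M) ℕ.+ (suc a ℕ.+ (M ℕ.+ suc a))
  split = ℕ-solve-∀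

windowIndex-neg : ∀ j M y → WindowIndex j (M ℕ.+ ℤ.∣ y ∣) (ℤ.- y)
windowIndex-neg j M (+ a) = windowIndex M (b≡a+c⇒+a-+b≡-c M (M ℕ.+ a) a refl) (s≤s (a≡b+c⇒b≤a (split a j M)))
  where
  split : ∀ a j M → j ℕ.+ (M ℕ.+ a) ℕ.+ (M ℕ.+ a) ≡ M ℕ.+ (j ℕ.+ a ℕ.+ (M ℕ.+ a))
  split = ℕ-solve-∀
windowIndex-neg j M -[1+ a ] = windowIndex (suc a ℕ.+ (M ℕ.+ suc a))
  (a≡c+b⇒+a-+b≡+c _ (M ℕ.+ suc a) (suc a) refl) (s≤s (a≡b+c⇒b≤a (split a j M)))
  where
  split : ∀ a j M → j ℕ.+ (M ℕ.+ suc a) ℕ.+ (M ℕ.+ suc a) ≡ (suc a ℕ.+ (M ℕ.+ suc a)) ℕ.+ (j ℕ.+ M)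
  split = ℕ-solve-∀

bNegSummand : ℕ → (Basis → ℚ) → Basis → ℤ → ℚ
bNegSummand j g b i = sgnℤ i * φᵀ i (φᵀ (+ j ℤ.- i) g) b

bNegWindowSum : ℕ → (Basis → ℚ) → Basis → ℕ → ℚ
bNegWindowSum j g b N = windowSum j N (bNegSummand j g b)

¼ : ℚ
¼ = ½ * ½

bNegᵀ-window : ∀ j g b → bNegᵀ j g b ≡ ¼ * bNegWindowSum j g b (sumℕ b)
bNegᵀ-window j g b =
  trans (pair-scale g ¼ (concatMap F (upTo K)))
   (cong (¼ *_) (trans (pair-concatMap g F (upTo K))
     (trans (∑ₗ-upTo K (λ t → pair g (F t)))
       (∑-cong K (λ t → trans (pair-scale g (sgnℤ (+ t ℤ.- + M)) (φ (+ j ℤ.- (+ t ℤ.- + M)) (φB (+ t ℤ.- + M) b)))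
                              (cong (sgnℤ (+ t ℤ.- + M) *_) (pair-φ g (+ j ℤ.- (+ t ℤ.- + M)) (φB (+ t ℤ.- + M) b))))))))
  where
    M = sumℕ b
    K = suc (j ℕ.+ M ℕ.+ M)
    F : ℕ → FVec
    F t = scale (sgnℤ (+ t ℤ.- + M)) (φ (+ j ℤ.- (+ t ℤ.- + M)) (φB (+ t ℤ.- + M) b))

windowSum-widen : ∀ j M d (F : ℤ → ℚ) → (∀ k → F (ℤ.- (+ (suc M ℕ.+ k))) ≡ 0ℚ) → (∀ k → F (+ suc (j ℕ.+ M ℕ.+ k)) ≡ 0ℚ) →
                  windowSum j (M ℕ.+ d) F ≡ windowSum j M F
windowSum-widen j M d F F-below F-above = begin
  ∑ (suc (j ℕ.+ (M ℕ.+ d) ℕ.+ (M ℕ.+ d))) G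
    ≡⟨ cong (λ n → ∑ n G) (widened-length j M d) ⟩
  ∑ (d ℕ.+ (K ℕ.+ d)) G
    ≡⟨ ∑-split d (K ℕ.+ d) G ⟩
  ∑ d G + ∑ (K ℕ.+ d) (λ t → G (d ℕ.+ t))
    ≡⟨ cong₂ _+_ (∑-zero-< d below) (∑-split K d (λ t → G (d ℕ.+ t))) ⟩
  0ℚ + (∑ K (λ t → G (d ℕ.+ t)) + ∑ d (λ t → G (d ℕ.+ (K ℕ.+ t))))
    ≡⟨ cong (λ y → 0ℚ + y) (cong₂ _+_ (∑-cong K (λ t → cong F (shifted-index d t M)))
                                      (∑-zero d (λ t → trans (cong F (a≡c+b⇒+a-+b≡+c _ _ _ (upper-index d j M t))) (F-above t)))) ⟩
  0ℚ + (∑ K (λ t → F (+ t ℤ.- + M)) + 0ℚ)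
    ≡⟨ trans (+-identityˡ _) (+-identityʳ _) ⟩
  ∑ K (λ t → F (+ t ℤ.- + M)) ∎
  where
    open ≡-Reasoning
    K = suc (j ℕ.+ M ℕ.+ M)
    G : ℕ → ℚ
    G t = F (+ t ℤ.- + (M ℕ.+ d))
    widened-length : ∀ j M d → suc (j ℕ.+ (M ℕ.+ d) ℕ.+ (M ℕ.+ d)) ≡ d ℕ.+ (suc (j ℕ.+ M ℕ.+ M) ℕ.+ d)
    widened-length = ℕ-solve-∀
    shifted-index : ∀ d t M → + (d ℕ.+ t) ℤ.- + (M ℕ.+ d) ≡ + t ℤ.- + M
    shifted-index d t M rewrite ℤP.pos-+ d t | ℤP.pos-+ M d = identity (+ d) (+ t) (+ M)
      where
      identity : ∀ (d t M : ℤ) → (d ℤ.+ t) ℤ.- (M ℤ.+ d) ≡ t ℤ.- M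
      identity = ℤ-solve-∀
    upper-index : ∀ d j M t → d ℕ.+ (suc (j ℕ.+ M ℕ.+ M) ℕ.+ t) ≡ suc (j ℕ.+ M ℕ.+ t) ℕ.+ (M ℕ.+ d)
    upper-index = ℕ-solve-∀
    lower-index : ∀ M t k → M ℕ.+ suc (t ℕ.+ k) ≡ t ℕ.+ suc (M ℕ.+ k)
    lower-index = ℕ-solve-∀
    below : ∀ t → t < d → G t ≡ 0ℚ
    below t p with ℕP.m≤n⇒∃[o]m+o≡n p
    ... | k , refl = trans (cong F (b≡a+c⇒+a-+b≡-c t (M ℕ.+ suc (t ℕ.+ k)) (suc M ℕ.+ k) (lower-index M t k))) (F-below k)

bNegSummand-below : ∀ j g b M → All (_≤ M) b → ∀ k → bNegSummand j g b (ℤ.- (+ (suc M ℕ.+ k))) ≡ 0ℚ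
bNegSummand-below j g b M bd k =
  trans (cong (sgnℤ (ℤ.- (+ (suc M ℕ.+ k))) *_) (annihᵀ-absent _ b (All.map (λ p e → ℕP.<⇒≢ (s≤s (ℕP.≤-trans p (ℕP.m≤m+n M k))) e) bd)))
        (*-zeroʳ (sgnℤ (ℤ.- (+ (suc M ℕ.+ k)))))

bNegSummand-above : ∀ j' g b M → All (_≤ M) b → ∀ k → bNegSummand (suc j') g b (+ suc (suc j' ℕ.+ M ℕ.+ k)) ≡ 0ℚ
bNegSummand-above j' g b M bd k =
  trans (cong (sgnℤ (+ suc (suc j' ℕ.+ M ℕ.+ k)) *_)
          (trans (cong (λ z → pair (φᵀ z g) (creat (suc (suc j' ℕ.+ M ℕ.+ k)) b)) (b≡a+c⇒+a-+b≡-c (suc j') _ (suc (M ℕ.+ k)) (index (suc j') M k)))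
            (trans (pair-cong-on (creat (suc (suc j' ℕ.+ M ℕ.+ k)) b)
                      (creat-all {P = λ e → ¬ (e ≡ suc (M ℕ.+ k))} b
                         (All.map (λ p e → ℕP.<⇒≢ (s≤s (ℕP.≤-trans p (ℕP.m≤m+n M k))) e) bd) ne)
                      (λ x p → annihᵀ-absent g x p))
                   (pair-0 (creat (suc (suc j' ℕ.+ M ℕ.+ k)) b)))))
        (*-zeroʳ (sgnℤ (+ suc (suc j' ℕ.+ M ℕ.+ k))))
  where
    ne : ¬ (suc (suc j' ℕ.+ M ℕ.+ k) ≡ suc (M ℕ.+ k))
    ne e = ℕP.<⇒≢ (s≤s (s≤s (ℕP.≤-trans (ℕP.m≤n+m (M ℕ.+ k) j') (ℕP.≤-reflexive (sym (ℕP.+-assoc j' M k)))))) (sym e)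
    index : ∀ j M k → suc (j ℕ.+ M ℕ.+ k) ≡ j ℕ.+ suc (M ℕ.+ k)
    index = ℕ-solve-∀

bNegWindowSum-widen : ∀ j' g b d → bNegWindowSum (suc j') g b (sumℕ b ℕ.+ d) ≡ bNegWindowSum (suc j') g b (sumℕ b)
bNegWindowSum-widen j' g b d = windowSum-widen (suc j') (sumℕ b) d (bNegSummand (suc j') g b)
  (bNegSummand-below (suc j') g b (sumℕ b) (All≤sumℕ b)) (bNegSummand-above j' g b (sumℕ b) (All≤sumℕ b))

bNegSummand-φᵀ : ∀ j y g b i → Decreasing b →
  bNegSummand j (φᵀ y g) b i ≡
    sgnℤ i * (anticommutator y (+ j ℤ.- i) * φᵀ i g b) + - (sgnℤ i * (anticommutator y i * φᵀ (+ j ℤ.- i) g b))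
    + sgnℤ i * φᵀ y (φᵀ i (φᵀ (+ j ℤ.- i) g)) b
bNegSummand-φᵀ j y g b i s = begin
  sgnℤ i * φᵀ i (φᵀ n (φᵀ y g)) b
    ≡⟨ cong (sgnℤ i *_) step1 ⟩
  sgnℤ i * (c1 * φᵀ i g b + - φᵀ i (φᵀ y h) b)
    ≡⟨ cong (λ z → sgnℤ i * (c1 * φᵀ i g b + - z)) (a+b≡c⇒a≡c-b _ _ _ (φᵀ-anticomm y i h b s)) ⟩
  sgnℤ i * (c1 * φᵀ i g b + - (c2 * h b + - φᵀ y (φᵀ i h) b))
    ≡⟨ solve 6 (λ s c1 P c2 Q R → s :* (c1 :* P :+ :- (c2 :* Q :+ :- R)) := s :* (c1 :* P) :+ :- (s :* (c2 :* Q)) :+ s :* R)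
               refl (sgnℤ i) c1 (φᵀ i g b) c2 (h b) (φᵀ y (φᵀ i h) b) ⟩
  sgnℤ i * (c1 * φᵀ i g b) + - (sgnℤ i * (c2 * h b)) + sgnℤ i * φᵀ y (φᵀ i h) b ∎
  where
    open ≡-Reasoning
    n = + j ℤ.- i
    h = φᵀ n g
    c1 = anticommutator y n
    c2 = anticommutator y i
    step1 : φᵀ i (φᵀ n (φᵀ y g)) b ≡ c1 * φᵀ i g b + - φᵀ i (φᵀ y h) b
    step1 = trans (pair-cong-on (φB i b) (φB-decreasing i b s) (λ x sx → a+b≡c⇒a≡c-b _ _ _ (φᵀ-anticomm y n g x sx)))
             (trans (pair-+ (λ x → c1 * g x) (λ x → - φᵀ y h x) (φB i b))
               (cong₂ _+_ (pair-* c1 g (φB i b)) (pair-neg (φᵀ y h) (φB i b))))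

HasWeight-gap : ∀ M y x → HasWeight (+ M ℤ.+ y) x → Σ ℕ (λ d' → M ℕ.+ ℤ.∣ y ∣ ≡ sumℕ x ℕ.+ d')
HasWeight-gap M (+ a) x e = 0 , trans (sym (ℤP.+-injective e)) (sym (ℕP.+-identityʳ _))
HasWeight-gap M -[1+ a ] x e = (suc a ℕ.+ suc a) ,
  trans (cong (ℕ._+ suc a) (M≡s+1+a M a (sumℕ x) e)) (ℕP.+-assoc (sumℕ x) (suc a) (suc a))
  where
  M≡s+1+a : ∀ M a s → + s ≡ + M ℤ.+ -[1+ a ] → M ≡ s ℕ.+ suc a
  M≡s+1+a M a s e = ℤP.+-injective (begin
    + M                                  ≡⟨ sym ([x-y]+y≡x (+ M) (+ suc a)) ⟩
    (+ M ℤ.+ -[1+ a ]) ℤ.+ + suc a       ≡⟨ cong (ℤ._+ + suc a) (sym e) ⟩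
    + s ℤ.+ + suc a                      ≡⟨ sym (ℤP.pos-+ s (suc a)) ⟩
    + (s ℕ.+ suc a)                      ∎) where open ≡-Reasoning
φᵀ-bNegᵀ : ∀ j' y g b →
  ¼ * windowSum (suc j') (sumℕ b ℕ.+ ℤ.∣ y ∣) (λ i → sgnℤ i * φᵀ y (φᵀ i (φᵀ (+ suc j' ℤ.- i) g)) b) ≡ φᵀ y (bNegᵀ (suc j') g) b
φᵀ-bNegᵀ j' y g b = begin
  ¼ * ∑ K (λ t → sgnℤ (it t) * φᵀ y (φᵀ (it t) (φᵀ (+ j ℤ.- it t) g)) b)
    ≡⟨ cong (¼ *_) (∑-cong K (λ t → sym (pair-* (sgnℤ (it t)) (φᵀ (it t) (φᵀ (+ j ℤ.- it t) g)) (φB y b)))) ⟩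
  ¼ * ∑ K (λ t → pair (λ x → bNegSummand j g x (it t)) (φB y b))
    ≡⟨ cong (¼ *_) (sym (pair-∑ K (λ t x → bNegSummand j g x (it t)) (φB y b))) ⟩
  ¼ * pair (λ x → bNegWindowSum j g x N) (φB y b)
    ≡⟨ sym (pair-* ¼ (λ x → bNegWindowSum j g x N) (φB y b)) ⟩
  pair (λ x → ¼ * bNegWindowSum j g x N) (φB y b)
    ≡⟨ pair-cong-on (φB y b) (φB-weight y b) window-suffices ⟩
  pair (bNegᵀ j g) (φB y b) ∎
  where
  open ≡-Reasoning
  j = suc j'
  N = sumℕ b ℕ.+ ℤ.∣ y ∣
  K = suc (j ℕ.+ N ℕ.+ N)
  it : ℕ → ℤ
  it t = + t ℤ.- + N
  window-suffices : ∀ x → HasWeight (+ sumℕ b ℤ.+ y) x → ¼ * bNegWindowSum j g x N ≡ bNegᵀ j g x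
  window-suffices x e with HasWeight-gap (sumℕ b) y x e
  ... | d , N≡x+d = trans (cong (λ n → ¼ * bNegWindowSum j g x n) N≡x+d)
                          (trans (cong (¼ *_) (bNegWindowSum-widen j' g x d)) (sym (bNegᵀ-window j g x)))

-- [b₋ⱼ, φ_y] = φ_{y+j} for odd j: only the summands with i = y + j and i = -y meet a nonzero anticommutator.
bNegᵀ-φᵀ : ∀ j' y g b → isEven (suc j') ≡ false → Decreasing b →
           bNegᵀ (suc j') (φᵀ y g) b ≡ φᵀ y (bNegᵀ (suc j') g) b + - φᵀ (y ℤ.+ + suc j') g b
bNegᵀ-φᵀ j' y g b odd s = begin
  bNegᵀ j (φᵀ y g) b
    ≡⟨ bNegᵀ-window j (φᵀ y g) b ⟩
  ¼ * windowSum j M (bNegSummand j (φᵀ y g) b)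
    ≡⟨ cong (¼ *_) (sym (bNegWindowSum-widen j' (φᵀ y g) b ℤ.∣ y ∣)) ⟩
  ¼ * windowSum j N (bNegSummand j (φᵀ y g) b)
    ≡⟨ cong (¼ *_) (trans (∑-cong K (λ t → bNegSummand-φᵀ j y g b (it t) s))
                    (trans (∑-+ K (λ t → A₁ (it t) + - A₂ (it t)) (λ t → A₃ (it t)))
                           (cong (_+ Σ₃) (trans (∑-+ K (λ t → A₁ (it t)) (λ t → - A₂ (it t)))
                                                (cong (_+_ Σ₁) (∑-neg K (λ t → A₂ (it t)))))))) ⟩
  ¼ * (Σ₁ + - Σ₂ + Σ₃)
    ≡⟨ cong₂ (λ u v → ¼ * (u + - v + Σ₃)) (windowSum-single A₁ (windowIndex-+ j M y) A₁≡0)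
                                          (windowSum-single A₂ (windowIndex-neg j M y) A₂≡0) ⟩
  ¼ * (A₁ (y ℤ.+ + j) + - A₂ (ℤ.- y) + Σ₃)
    ≡⟨ cong₂ (λ u v → ¼ * (u + - v + Σ₃)) A₁-value A₂-value ⟩
  ¼ * ((sy * - 1ℚ) * (ℕtoℚ 2 * sy * P) + - (sy * (ℕtoℚ 2 * sy * P)) + Σ₃)
    ≡⟨ solve 4 (λ sy P Z q → q :* ((sy :* (:- con 1ℚ)) :* (con (ℕtoℚ 2) :* sy :* P) :+ :- (sy :* (con (ℕtoℚ 2) :* sy :* P)) :+ Z)
                    := q :* Z :+ :- ((con (ℕtoℚ 2) :+ con (ℕtoℚ 2)) :* q :* (sy :* sy) :* P)) refl sy P Σ₃ ¼ ⟩
  ¼ * Σ₃ + - ((ℕtoℚ 2 + ℕtoℚ 2) * ¼ * (sy * sy) * P)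
    ≡⟨ cong₂ (λ u v → u + - (v * P)) (φᵀ-bNegᵀ j' y g b) (cong ((ℕtoℚ 2 + ℕtoℚ 2) * ¼ *_) (sgnℤ-square y)) ⟩
  φᵀ y (bNegᵀ j g) b + - (1ℚ * P)
    ≡⟨ cong (λ z → φᵀ y (bNegᵀ j g) b + - z) (*-identityˡ P) ⟩
  φᵀ y (bNegᵀ j g) b + - P ∎
  where
  open ≡-Reasoning
  j = suc j'
  M = sumℕ b
  N = M ℕ.+ ℤ.∣ y ∣
  K = suc (j ℕ.+ N ℕ.+ N)
  it : ℕ → ℤ
  it t = + t ℤ.- + N
  sy = sgnℤ y
  P = φᵀ (y ℤ.+ + j) g b
  A₁ A₂ A₃ : ℤ → ℚ
  A₁ i = sgnℤ i * (anticommutator y (+ j ℤ.- i) * φᵀ i g b)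
  A₂ i = sgnℤ i * (anticommutator y i * φᵀ (+ j ℤ.- i) g b)
  A₃ i = sgnℤ i * φᵀ y (φᵀ i (φᵀ (+ j ℤ.- i) g)) b
  Σ₁ = windowSum j N A₁
  Σ₂ = windowSum j N A₂
  Σ₃ = windowSum j N A₃
  s*[0*x]≡0 : ∀ s c x → c ≡ 0ℚ → s * (c * x) ≡ 0ℚ
  s*[0*x]≡0 s c x c≡0 rewrite c≡0 = trans (cong (s *_) (*-zeroˡ x)) (*-zeroʳ s)
  A₁≡0 : ∀ i → ¬ (i ≡ y ℤ.+ + j) → A₁ i ≡ 0ℚ
  A₁≡0 i i≢ = s*[0*x]≡0 (sgnℤ i) _ (φᵀ i g b) (anticommutator-≢ y (+ j ℤ.- i) (λ e → i≢ (y+[j-i]≡0⇒i≡y+j y (+ j) i e)))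
  A₂≡0 : ∀ i → ¬ (i ≡ ℤ.- y) → A₂ i ≡ 0ℚ
  A₂≡0 i i≢ = s*[0*x]≡0 (sgnℤ i) _ (φᵀ (+ j ℤ.- i) g b) (anticommutator-≢ y i (λ e → i≢ (y+i≡0⇒i≡-y y i e)))
  A₁-value : A₁ (y ℤ.+ + j) ≡ (sy * - 1ℚ) * (ℕtoℚ 2 * sy * P)
  A₁-value = cong₂ _*_ (trans (sgnℤ-+ y (+ j)) (cong (sy *_) (sgnℕ-odd j odd)))
                       (cong (_* P) (trans (cong (anticommutator y) (j-[y+j]≡-y (+ j) y)) (anticommutator-neg y)))
  A₂-value : A₂ (ℤ.- y) ≡ sy * (ℕtoℚ 2 * sy * P)
  A₂-value = cong₂ _*_ (sgnℤ-neg y) (cong₂ _*_ (anticommutator-neg y) (cong (λ z → φᵀ z g b) (j-[-y]≡y+j (+ j) y)))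

-- Power series, as coefficient sequences
conv : (ℕ → ℚ) → (ℕ → ℚ) → ℕ → ℚ
conv f g k = ∑ (suc k) (λ i → f i * g (k ∸ i))

conv-sucʳ : ∀ f g k → conv f g (suc k) ≡ conv f (λ m → g (suc m)) k + f (suc k) * g 0
conv-sucʳ f g k = trans (∑-last (suc k) (λ i → f i * g (suc k ∸ i)))
  (cong₂ _+_ (∑-cong-< (suc k) (λ i p → cong (λ z → f i * g z) (ℕP.+-∸-assoc 1 (ℕP.≤-pred p))))
             (cong (λ z → f (suc k) * g z) (ℕP.n∸n≡0 k)))

conv-cong : ∀ {f f' g g'} k → (∀ i → f i ≡ f' i) → (∀ m → g m ≡ g' m) → conv f g k ≡ conv f' g' k
conv-cong k ef eg = ∑-cong (suc k) (λ i → cong₂ _*_ (ef i) (eg (k ∸ i)))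

conv-cong-≤ : ∀ {f g g'} k → (∀ i → i ≤ k → f i * g (k ∸ i) ≡ f i * g' (k ∸ i)) → conv f g k ≡ conv f g' k
conv-cong-≤ k e = ∑-cong-< (suc k) (λ i p → e i (ℕP.≤-pred p))

conv-comm : ∀ f g k → conv f g k ≡ conv g f k
conv-comm f g zero = cong (_+ 0ℚ) (*-comm (f 0) (g 0))
conv-comm f g (suc k) = begin
  f 0 * g (suc k) + conv (λ i → f (suc i)) g k
    ≡⟨ cong (λ zz → f 0 * g (suc k) + zz) (conv-comm (λ i → f (suc i)) g k) ⟩
  f 0 * g (suc k) + conv g (λ i → f (suc i)) k
    ≡⟨ trans (+-comm (f 0 * g (suc k)) (conv g (λ i → f (suc i)) k)) (cong (λ zz → conv g (λ i → f (suc i)) k + zz) (*-comm (f 0) (g (suc k)))) ⟩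
  conv g (λ i → f (suc i)) k + g (suc k) * f 0
    ≡⟨ sym (conv-sucʳ g f k) ⟩
  conv g f (suc k) ∎ where open ≡-Reasoning

conv-+ˡ : ∀ f f' g k → conv (λ i → f i + f' i) g k ≡ conv f g k + conv f' g k
conv-+ˡ f f' g k = trans (∑-cong (suc k) (λ i → *-distribʳ-+ (g (k ∸ i)) (f i) (f' i))) (∑-+ (suc k) (λ i → f i * g (k ∸ i)) (λ i → f' i * g (k ∸ i)))

conv-+ʳ : ∀ f g g' k → conv f (λ m → g m + g' m) k ≡ conv f g k + conv f g' k
conv-+ʳ f g g' k = trans (∑-cong (suc k) (λ i → *-distribˡ-+ (f i) (g (k ∸ i)) (g' (k ∸ i))))
                           (∑-+ (suc k) (λ i → f i * g (k ∸ i)) (λ i → f i * g' (k ∸ i)))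

conv-*ˡ : ∀ c f g k → conv (λ i → c * f i) g k ≡ c * conv f g k
conv-*ˡ c f g k = trans (∑-cong (suc k) (λ i → *-assoc c (f i) (g (k ∸ i)))) (∑-* (suc k) c (λ i → f i * g (k ∸ i)))

conv-*ʳ : ∀ c f g k → conv f (λ m → c * g m) k ≡ c * conv f g k
conv-*ʳ c f g k = trans (∑-cong (suc k) (λ i → solve 3 (λ c x y → x :* (c :* y) := c :* (x :* y)) refl c (f i) (g (k ∸ i)))) (∑-* (suc k) c (λ i → f i * g (k ∸ i)))

conv-assoc : ∀ f g h k → conv f (conv g h) k ≡ conv (conv f g) h k
conv-assoc f g h zero = solve 3 (λ a b c → a :* (b :* c :+ con 0ℚ) :+ con 0ℚ := (a :* b :+ con 0ℚ) :* c :+ con 0ℚ) refl (f 0) (g 0) (h 0)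
conv-assoc f g h (suc k) = begin
  f 0 * conv g h (suc k) + conv (λ i → f (suc i)) (conv g h) k
    ≡⟨ cong (λ zz → f 0 * conv g h (suc k) + zz) (conv-assoc (λ i → f (suc i)) g h k) ⟩
  f 0 * (g 0 * h (suc k) + P) + Q
    ≡⟨ solve 5 (λ f0 g0 h1 P Q → f0 :* (g0 :* h1 :+ P) :+ Q := (f0 :* g0 :+ con 0ℚ) :* h1 :+ (f0 :* P :+ Q)) refl (f 0) (g 0) (h (suc k)) P Q ⟩
  (f 0 * g 0 + 0ℚ) * h (suc k) + (f 0 * P + Q)
    ≡⟨ cong (λ zz → (f 0 * g 0 + 0ℚ) * h (suc k) + zz) (sym (trans (conv-+ˡ (λ m → f 0 * g (suc m)) (conv (λ i → f (suc i)) g) h k)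
                                                         (cong (_+ Q) (conv-*ˡ (f 0) (λ m → g (suc m)) h k)))) ⟩
  (f 0 * g 0 + 0ℚ) * h (suc k) + conv (λ m → conv f g (suc m)) h k
    ≡⟨⟩
  conv (conv f g) h (suc k) ∎ where
    open ≡-Reasoning
    P = conv (λ m → g (suc m)) h k
    Q = conv (conv (λ i → f (suc i)) g) h k

conv-leftComm : ∀ f g h k → conv f (conv g h) k ≡ conv g (conv f h) k
conv-leftComm f g h k = trans (conv-assoc f g h k)
  (trans (conv-cong {g = h} {g' = h} k (λ m → conv-comm f g m) (λ _ → refl)) (sym (conv-assoc g f h k)))

conv-∑ : ∀ f n (F : ℕ → ℕ → ℚ) k → conv f (λ m → ∑ n (λ r → F r m)) k ≡ ∑ n (λ r → conv f (F r) k)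
conv-∑ f zero F k = trans (∑-cong (suc k) (λ i → *-zeroʳ (f i))) (∑-zero (suc k) (λ _ → refl))
conv-∑ f (suc n) F k = begin
  conv f (λ m → F 0 m + ∑ n (λ r → F (suc r) m)) k
    ≡⟨ ∑-cong (suc k) (λ i → *-distribˡ-+ (f i) (F 0 (k ∸ i)) (∑ n (λ r → F (suc r) (k ∸ i)))) ⟩
  ∑ (suc k) (λ i → f i * F 0 (k ∸ i) + f i * ∑ n (λ r → F (suc r) (k ∸ i)))
    ≡⟨ ∑-+ (suc k) (λ i → f i * F 0 (k ∸ i)) (λ i → f i * ∑ n (λ r → F (suc r) (k ∸ i))) ⟩
  conv f (F 0) k + conv f (λ m → ∑ n (λ r → F (suc r) m)) k
    ≡⟨ cong (λ zz → conv f (F 0) k + zz) (conv-∑ f n (λ r → F (suc r)) k) ⟩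
  conv f (F 0) k + ∑ n (λ r → conv f (F (suc r)) k) ∎ where open ≡-Reasoning

oneSeries : ℕ → ℚ
oneSeries zero = 1ℚ
oneSeries (suc _) = 0ℚ

oneSeries-∸ : ∀ {i k} → i < suc k → ¬ (i ≡ k) → oneSeries (k ∸ i) ≡ 0ℚ
oneSeries-∸ {i} i<1+k i≢k with ℕP.m≤n⇒∃[o]m+o≡n (ℕP.≤∧≢⇒< (ℕP.≤-pred i<1+k) i≢k)
... | d , refl rewrite suc-+-∸ i d = refl

convPow : (ℕ → ℚ) → ℕ → ℕ → ℚ
convPow σ zero k = oneSeries k
convPow σ (suc r) k = conv σ (convPow σ r) k

convExp : (ℕ → ℚ) → ℕ → ℚ
convExp σ k = ∑ (suc k) (λ r → recipℕ (r !) * convPow σ r k)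

-- The Euler operator β d/dβ.
deriv : (ℕ → ℚ) → ℕ → ℚ
deriv σ i = ℕtoℚ i * σ i

convPow-vanish : ∀ σ → σ 0 ≡ 0ℚ → ∀ r m → m < r → convPow σ r m ≡ 0ℚ
convPow-vanish σ z (suc r) m p = ∑-zero-< (suc m) f
  where
    f : ∀ i → i < suc m → σ i * convPow σ r (m ∸ i) ≡ 0ℚ
    f zero q rewrite z = *-zeroˡ (convPow σ r m)
    f (suc i) q = trans (cong (σ (suc i) *_) (convPow-vanish σ z r (m ∸ suc i) (∸-suc-< m i r q p))) (*-zeroʳ (σ (suc i)))

deriv-conv : ∀ f g k → ℕtoℚ k * conv f g k ≡ conv (deriv f) g k + conv f (deriv g) k
deriv-conv f g k = trans (sym (∑-* (suc k) (ℕtoℚ k) (λ i → f i * g (k ∸ i))))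
  (trans (∑-cong-< (suc k) term) (∑-+ (suc k) (λ i → (ℕtoℚ i * f i) * g (k ∸ i)) (λ i → f i * (ℕtoℚ (k ∸ i) * g (k ∸ i)))))
  where
    term : ∀ i → i < suc k → ℕtoℚ k * (f i * g (k ∸ i)) ≡ (ℕtoℚ i * f i) * g (k ∸ i) + f i * (ℕtoℚ (k ∸ i) * g (k ∸ i))
    term i p = trans (cong (λ z → z * (f i * g (k ∸ i))) (trans (cong ℕtoℚ (sym (ℕP.m+[n∸m]≡n (ℕP.≤-pred p)))) (ℕtoℚ-+ i (k ∸ i))))
               (solve 4 (λ a b x y → (a :+ b) :* (x :* y) := (a :* x) :* y :+ x :* (b :* y)) refl (ℕtoℚ i) (ℕtoℚ (k ∸ i)) (f i) (g (k ∸ i)))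

deriv-oneSeries : ∀ m → deriv oneSeries m ≡ 0ℚ
deriv-oneSeries zero = refl
deriv-oneSeries (suc m) = *-zeroʳ (ℕtoℚ (suc m))

deriv-convPow : ∀ σ r k → ℕtoℚ k * convPow σ (suc r) k ≡ ℕtoℚ (suc r) * conv (deriv σ) (convPow σ r) k
deriv-convPow σ zero k = begin
  ℕtoℚ k * conv σ oneSeries k
    ≡⟨ deriv-conv σ oneSeries k ⟩
  conv (deriv σ) oneSeries k + conv σ (deriv oneSeries) k
    ≡⟨ cong (_+_ (conv (deriv σ) oneSeries k))
            (trans (conv-cong {f = σ} {f' = σ} k (λ _ → refl) deriv-oneSeries)
                   (trans (∑-cong (suc k) (λ i → *-zeroʳ (σ i))) (∑-zero (suc k) (λ _ → refl)))) ⟩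
  conv (deriv σ) oneSeries k + 0ℚ
    ≡⟨ trans (+-identityʳ (conv (deriv σ) oneSeries k)) (sym (*-identityˡ (conv (deriv σ) oneSeries k))) ⟩
  ℕtoℚ 1 * conv (deriv σ) oneSeries k ∎ where open ≡-Reasoning
deriv-convPow σ (suc r) k = begin
  ℕtoℚ k * conv σ (convPow σ (suc r)) k
    ≡⟨ deriv-conv σ (convPow σ (suc r)) k ⟩
  X + conv σ (deriv (convPow σ (suc r))) k
    ≡⟨ cong (_+_ X) (trans (conv-cong {f = σ} {f' = σ} k (λ _ → refl) (λ m → deriv-convPow σ r m))
                     (trans (conv-*ʳ (ℕtoℚ (suc r)) σ (conv (deriv σ) (convPow σ r)) k)
                       (cong (ℕtoℚ (suc r) *_) (conv-leftComm σ (deriv σ) (convPow σ r) k)))) ⟩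
  X + ℕtoℚ (suc r) * X
    ≡⟨ solve 2 (λ X c → X :+ c :* X := (con 1ℚ :+ c) :* X) refl X (ℕtoℚ (suc r)) ⟩
  (1ℚ + ℕtoℚ (suc r)) * X
    ≡⟨ cong (_* X) (sym (ℕtoℚ-suc (suc r))) ⟩
  ℕtoℚ (suc (suc r)) * X ∎ where
    open ≡-Reasoning
    X = conv (deriv σ) (convPow σ (suc r)) k

convExp-truncation : ∀ σ → σ 0 ≡ 0ℚ → ∀ {m n} → m < n → ∑ n (λ r → recipℕ (r !) * convPow σ r m) ≡ convExp σ m
convExp-truncation σ σ₀≡0 {m} m<n with ℕP.m≤n⇒∃[o]m+o≡n m<n
... | d , refl = ∑-vanishing-tail (suc m) d (λ r → recipℕ (r !) * convPow σ r m) tail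
  where
  tail : ∀ r → recipℕ ((suc m ℕ.+ r) !) * convPow σ (suc m ℕ.+ r) m ≡ 0ℚ
  tail r = trans (cong (recipℕ ((suc m ℕ.+ r) !) *_) (convPow-vanish σ σ₀≡0 (suc m ℕ.+ r) m (s≤s (ℕP.m≤m+n m r))))
                 (*-zeroʳ (recipℕ ((suc m ℕ.+ r) !)))

convExp-ode : ∀ σ → σ 0 ≡ 0ℚ → ∀ k → ℕtoℚ k * convExp σ k ≡ conv (deriv σ) (convExp σ) k
convExp-ode σ z k = begin
  ℕtoℚ k * (recipℕ 1 * oneSeries k + ∑ k (λ r → recipℕ (suc r !) * convPow σ (suc r) k))
    ≡⟨ *-distribˡ-+ (ℕtoℚ k) (recipℕ 1 * oneSeries k) (∑ k (λ r → recipℕ (suc r !) * convPow σ (suc r) k)) ⟩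
  ℕtoℚ k * (recipℕ 1 * oneSeries k) + ℕtoℚ k * ∑ k (λ r → recipℕ (suc r !) * convPow σ (suc r) k)
    ≡⟨ cong₂ _+_ (first k) (sym (∑-* k (ℕtoℚ k) (λ r → recipℕ (suc r !) * convPow σ (suc r) k))) ⟩
  0ℚ + ∑ k (λ r → ℕtoℚ k * (recipℕ (suc r !) * convPow σ (suc r) k))
    ≡⟨ trans (+-identityˡ (∑ k (λ r → ℕtoℚ k * (recipℕ (suc r !) * convPow σ (suc r) k)))) (∑-cong k step) ⟩
  ∑ k (λ r → recipℕ (r !) * conv (deriv σ) (convPow σ r) k)
    ≡⟨ ∑-cong k (λ r → sym (conv-*ʳ (recipℕ (r !)) (deriv σ) (convPow σ r) k)) ⟩
  ∑ k (λ r → conv (deriv σ) (λ m → recipℕ (r !) * convPow σ r m) k)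
    ≡⟨ sym (conv-∑ (deriv σ) k (λ r m → recipℕ (r !) * convPow σ r m) k) ⟩
  conv (deriv σ) (λ m → ∑ k (λ r → recipℕ (r !) * convPow σ r m)) k
    ≡⟨ conv-cong-≤ {f = deriv σ} {g = λ m → ∑ k (λ r → recipℕ (r !) * convPow σ r m)} {g' = convExp σ} k last ⟩
  conv (deriv σ) (convExp σ) k ∎
  where
    open ≡-Reasoning
    first : ∀ k → ℕtoℚ k * (recipℕ 1 * oneSeries k) ≡ 0ℚ
    first zero = refl
    first (suc k) = trans (cong (ℕtoℚ (suc k) *_) (*-zeroʳ (recipℕ 1))) (*-zeroʳ (ℕtoℚ (suc k)))
    step : ∀ r → ℕtoℚ k * (recipℕ (suc r !) * convPow σ (suc r) k) ≡ recipℕ (r !) * conv (deriv σ) (convPow σ r) k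
    step r = begin
      ℕtoℚ k * (recipℕ (suc r !) * convPow σ (suc r) k)
        ≡⟨ solve 3 (λ a b c → a :* (b :* c) := b :* (a :* c)) refl (ℕtoℚ k) (recipℕ (suc r !)) (convPow σ (suc r) k) ⟩
      recipℕ (suc r !) * (ℕtoℚ k * convPow σ (suc r) k)
        ≡⟨ cong (recipℕ (suc r !) *_) (deriv-convPow σ r k) ⟩
      recipℕ (suc r !) * (ℕtoℚ (suc r) * conv (deriv σ) (convPow σ r) k)
        ≡⟨ sym (*-assoc (recipℕ (suc r !)) (ℕtoℚ (suc r)) (conv (deriv σ) (convPow σ r) k)) ⟩
      (recipℕ (suc r !) * ℕtoℚ (suc r)) * conv (deriv σ) (convPow σ r) k
        ≡⟨ cong (_* conv (deriv σ) (convPow σ r) k) (recipℕ-!-suc r) ⟩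
      recipℕ (r !) * conv (deriv σ) (convPow σ r) k ∎
    last : ∀ i → i ≤ k → deriv σ i * ∑ k (λ r → recipℕ (r !) * convPow σ r (k ∸ i)) ≡ deriv σ i * convExp σ (k ∸ i)
    last zero p = trans (cong (_* X) d0) (trans (*-zeroˡ X) (sym (trans (cong (_* Y) d0) (*-zeroˡ Y))))
      where
        X = ∑ k (λ r → recipℕ (r !) * convPow σ r (k ∸ 0))
        Y = convExp σ (k ∸ 0)
        d0 : deriv σ 0 ≡ 0ℚ
        d0 = *-zeroˡ (σ 0)
    last (suc i) p = cong (deriv σ (suc i) *_) (convExp-truncation σ z (∸-suc-≤ k i p))

ode-unique : ∀ (h X Y : ℕ → ℚ) → h 0 ≡ 0ℚ → X 0 ≡ Y 0 →
       (∀ k → ℕtoℚ k * X k ≡ conv h X k) → (∀ k → ℕtoℚ k * Y k ≡ conv h Y k) → ∀ k → X k ≡ Y k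
ode-unique h X Y h0 e0 ox oy k = up-to k k ℕP.≤-refl
  where
    up-to : ∀ n m → m ≤ n → X m ≡ Y m
    up-to zero .zero z≤n = e0
    up-to (suc n) m p with ℕP.m≤n⇒m<n∨m≡n p
    ... | inj₁ q = up-to n m (ℕP.≤-pred q)
    ... | inj₂ refl = begin
      X (suc n)
        ≡⟨ sym (trans (cong (_* X (suc n)) (recipℕ-inverseˡ n)) (*-identityˡ (X (suc n)))) ⟩
      (recipℕ (suc n) * ℕtoℚ (suc n)) * X (suc n)
        ≡⟨ *-assoc (recipℕ (suc n)) (ℕtoℚ (suc n)) (X (suc n)) ⟩
      recipℕ (suc n) * (ℕtoℚ (suc n) * X (suc n))
        ≡⟨ cong (recipℕ (suc n) *_) (trans (ox (suc n)) (trans (conv-cong-≤ {f = h} {g = X} {g' = Y} (suc n) term) (sym (oy (suc n))))) ⟩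
      recipℕ (suc n) * (ℕtoℚ (suc n) * Y (suc n))
        ≡⟨ sym (*-assoc (recipℕ (suc n)) (ℕtoℚ (suc n)) (Y (suc n))) ⟩
      (recipℕ (suc n) * ℕtoℚ (suc n)) * Y (suc n)
        ≡⟨ trans (cong (_* Y (suc n)) (recipℕ-inverseˡ n)) (*-identityˡ (Y (suc n))) ⟩
      Y (suc n) ∎
      where
        open ≡-Reasoning
        term : ∀ i → i ≤ suc n → h i * X (suc n ∸ i) ≡ h i * Y (suc n ∸ i)
        term zero _ rewrite h0 = trans (*-zeroˡ (X (suc n))) (sym (*-zeroˡ (Y (suc n))))
        term (suc i) q = cong (h (suc i) *_) (up-to n (n ∸ i) (ℕP.m∸n≤m n i))

-- θ* = Σᵢ τᵢ βⁱ b₋ᵢ, and ρ is the coefficient sequence of (1 - β/2)/(1 + β/2) = e^{-τ}.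
τ : ℕ → ℚ
τ i = if isEven i then 0ℚ else ℕtoℚ 2 * powℚ ½ i * recipℕ i

negτ : ℕ → ℚ
negτ i = - τ i

deriv-negτ-closed : ℕ → ℚ
deriv-negτ-closed i = if isEven i then 0ℚ else - (ℕtoℚ 2 * powℚ ½ i)

ρ : ℕ → ℚ
ρ zero = 1ℚ
ρ (suc m) = powℚ ½ (suc m) * twoSign (suc m)

deriv-negτ : ∀ i → deriv negτ i ≡ deriv-negτ-closed i
deriv-negτ zero = refl
deriv-negτ (suc i) with isEven (suc i)
... | true = *-zeroʳ (ℕtoℚ (suc i))
... | false = trans (solve 4 (λ x a p r → x :* (:- (a :* p :* r)) := :- (a :* p) :* (r :* x)) refl
                      (ℕtoℚ (suc i)) (ℕtoℚ 2) (powℚ ½ (suc i)) (recipℕ (suc i)))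
                    (trans (cong (λ z → - (ℕtoℚ 2 * powℚ ½ (suc i)) * z) (recipℕ-inverseˡ i)) (*-identityʳ _))

-- (1 + β/2) ρ = 1 - β/2, read off coefficientwise.
ρ-defect : ℕ → ℚ
ρ-defect zero = - ½
ρ-defect (suc _) = 0ℚ

ρ-rec : ∀ m → ρ (suc m) ≡ - ½ * ρ m + ρ-defect m
ρ-rec zero = refl
ρ-rec (suc m) with isEven (suc m) | isEven-suc (suc m)
... | true | e rewrite e = solve 1 (λ p → con ½ :* p :* (con (ℕtoℚ 2) :* (:- con 1ℚ)) := (:- con ½) :* (p :* (con (ℕtoℚ 2) :* con 1ℚ)) :+ con 0ℚ) refl (powℚ ½ (suc m))
... | false | e rewrite e = solve 1 (λ p → con ½ :* p :* (con (ℕtoℚ 2) :* con 1ℚ) := (:- con ½) :* (p :* (con (ℕtoℚ 2) :* (:- con 1ℚ))) :+ con 0ℚ) refl (powℚ ½ (suc m))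

conv-ρ-defect : ∀ k → conv deriv-negτ-closed ρ-defect k ≡ deriv-negτ-closed k * (- ½)
conv-ρ-defect k = trans (∑-single (suc k) k (λ i → deriv-negτ-closed i * ρ-defect (k ∸ i)) (ℕP.n<1+n k) off-diagonal)
                  (cong (λ n → deriv-negτ-closed k * ρ-defect n) (ℕP.n∸n≡0 k))
  where
    off-diagonal : ∀ i → i < suc k → ¬ (i ≡ k) → deriv-negτ-closed i * ρ-defect (k ∸ i) ≡ 0ℚ
    off-diagonal i p ne with ℕP.m≤n⇒∃[o]m+o≡n (ℕP.≤∧≢⇒< (ℕP.≤-pred p) ne)
    ... | d , refl rewrite suc-+-∸ i d = *-zeroʳ (deriv-negτ-closed i)

ρ-ode-step : ∀ m → deriv-negτ-closed (suc m) * (- ½) + deriv-negτ-closed (suc (suc m)) * 1ℚ ≡ - ½ * ρ (suc m)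
ρ-ode-step m with isEven (suc m) | isEven-suc (suc m)
... | true | e rewrite e = solve 1 (λ p → con 0ℚ :* (:- con ½) :+ (:- (con (ℕtoℚ 2) :* (con ½ :* p))) :* con 1ℚ
                                          := (:- con ½) :* (p :* (con (ℕtoℚ 2) :* con 1ℚ))) refl (powℚ ½ (suc m))
... | false | e rewrite e = solve 1 (λ p → (:- (con (ℕtoℚ 2) :* p)) :* (:- con ½) :+ con 0ℚ :* con 1ℚ
                                          := (:- con ½) :* (p :* (con (ℕtoℚ 2) :* (:- con 1ℚ)))) refl (powℚ ½ (suc m))

ρ-ode : ∀ k → ℕtoℚ k * ρ k ≡ conv deriv-negτ-closed ρ k
ρ-ode zero = refl
ρ-ode (suc k) = sym (begin
  conv deriv-negτ-closed ρ (suc k)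
    ≡⟨ conv-sucʳ deriv-negτ-closed ρ k ⟩
  conv deriv-negτ-closed (λ m → ρ (suc m)) k + deriv-negτ-closed (suc k) * 1ℚ
    ≡⟨ cong (_+ deriv-negτ-closed (suc k) * 1ℚ) (trans (conv-cong {f = deriv-negτ-closed} {f' = deriv-negτ-closed} k (λ _ → refl) ρ-rec)
                                   (trans (conv-+ʳ deriv-negτ-closed (λ m → - ½ * ρ m) ρ-defect k)
                                     (cong₂ _+_ (conv-*ʳ (- ½) deriv-negτ-closed ρ k) (conv-ρ-defect k)))) ⟩
  - ½ * conv deriv-negτ-closed ρ k + deriv-negτ-closed k * (- ½) + deriv-negτ-closed (suc k) * 1ℚ
    ≡⟨ cong (λ z → - ½ * z + deriv-negτ-closed k * (- ½) + deriv-negτ-closed (suc k) * 1ℚ) (sym (ρ-ode k)) ⟩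
  - ½ * (ℕtoℚ k * ρ k) + deriv-negτ-closed k * (- ½) + deriv-negτ-closed (suc k) * 1ℚ
    ≡⟨ fin k ⟩
  ℕtoℚ (suc k) * ρ (suc k) ∎)
  where
    open ≡-Reasoning
    fin : ∀ k → - ½ * (ℕtoℚ k * ρ k) + deriv-negτ-closed k * (- ½) + deriv-negτ-closed (suc k) * 1ℚ ≡ ℕtoℚ (suc k) * ρ (suc k)
    fin zero = refl
    fin (suc m) = begin
      - ½ * (c * F) + deriv-negτ-closed (suc m) * (- ½) + deriv-negτ-closed (suc (suc m)) * 1ℚ
        ≡⟨ +-assoc (- ½ * (c * F)) _ _ ⟩
      - ½ * (c * F) + (deriv-negτ-closed (suc m) * (- ½) + deriv-negτ-closed (suc (suc m)) * 1ℚ)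
        ≡⟨ cong (_+_ (- ½ * (c * F))) (ρ-ode-step m) ⟩
      - ½ * (c * F) + - ½ * F
        ≡⟨ solve 2 (λ c F → (:- con ½) :* (c :* F) :+ (:- con ½) :* F := (con 1ℚ :+ c) :* ((:- con ½) :* F :+ con 0ℚ)) refl c F ⟩
      (1ℚ + c) * (- ½ * F + 0ℚ)
        ≡⟨ cong₂ _*_ (sym (ℕtoℚ-suc (suc m))) (sym (ρ-rec (suc m))) ⟩
      ℕtoℚ (suc (suc m)) * ρ (suc (suc m)) ∎
      where
        c = ℕtoℚ (suc m)
        F = ρ (suc m)

convExp-negτ : ∀ k → convExp negτ k ≡ ρ k
convExp-negτ = ode-unique deriv-negτ-closed (convExp negτ) ρ refl refl
  (λ k → trans (convExp-ode negτ refl k) (conv-cong {g = convExp negτ} {g' = convExp negτ} k deriv-negτ (λ _ → refl))) ρ-ode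

-- Two-point functions ⟨vac| φ_x φ_y (θ*)ʳ |vac⟩
twoPointᵀ : ℤ → ℤ → Basis → ℚ
twoPointᵀ x y = φᵀ y (φᵀ x vacᵀ)

bNegᵀ-twoPointᵀ : ∀ j' x y b → isEven (suc j') ≡ false → Decreasing b →
       bNegᵀ (suc j') (twoPointᵀ x y) b ≡ - twoPointᵀ (x ℤ.+ + suc j') y b + - twoPointᵀ x (y ℤ.+ + suc j') b
bNegᵀ-twoPointᵀ j' x y b odd s = begin
  bNegᵀ (suc j') (φᵀ y h) b
    ≡⟨ bNegᵀ-φᵀ j' y h b odd s ⟩
  φᵀ y (bNegᵀ (suc j') h) b + - φᵀ (y ℤ.+ + suc j') h b
    ≡⟨ cong (_+ - φᵀ (y ℤ.+ + suc j') h b) inner ⟩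
  - twoPointᵀ (x ℤ.+ + suc j') y b + - twoPointᵀ x (y ℤ.+ + suc j') b ∎
  where
    open ≡-Reasoning
    h = φᵀ x vacᵀ
    inner : φᵀ y (bNegᵀ (suc j') h) b ≡ - twoPointᵀ (x ℤ.+ + suc j') y b
    inner = trans (pair-cong-on (φB y b) (φB-decreasing y b s)
                    (λ x' s' → trans (bNegᵀ-φᵀ j' x vacᵀ x' odd s')
                                (trans (cong (_+ - φᵀ (x ℤ.+ + suc j') vacᵀ x')
                                         (trans (pair-cong (φB x x') (λ z → bNegᵀ-vac j' z)) (pair-0 (φB x x'))))
                                       (+-identityˡ (- φᵀ (x ℤ.+ + suc j') vacᵀ x')))))
                  (pair-neg (φᵀ (x ℤ.+ + suc j') vacᵀ) (φB y b))

AllTerms-bNeg : ∀ {P Q : Basis → Set} j v → AllTerms Q v → (∀ b → Q b → AllTerms P (bNegB j b)) → AllTerms P (bNeg j v)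
AllTerms-bNeg j [] [] f = []
AllTerms-bNeg j ((a , b) ∷ v) (q ∷ qs) f = AllTerms-++ (scale a (bNegB j b)) (bNeg j v) (AllTerms-scale a (bNegB j b) (f b q)) (AllTerms-bNeg j v qs f)

bNegB-decreasing : ∀ j b → Decreasing b → AllTerms Decreasing (bNegB j b)
bNegB-decreasing j b s = AllTerms-scale (½ * ½) _
  (AllTerms-concatMap (λ t → scale (sgnℤ (+ t ℤ.- + M)) (φ (+ j ℤ.- (+ t ℤ.- + M)) (φB (+ t ℤ.- + M) b))) (upTo (suc (j ℕ.+ M ℕ.+ M)))
    (λ t → AllTerms-scale (sgnℤ (+ t ℤ.- + M)) _ (AllTerms-φ (+ j ℤ.- (+ t ℤ.- + M)) (φB (+ t ℤ.- + M) b) (φB-decreasing (+ t ℤ.- + M) b s)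
             (λ x sx → φB-decreasing (+ j ℤ.- (+ t ℤ.- + M)) x sx))))
  where M = sumℕ b

θ*-decreasing : ∀ i v → AllTerms Decreasing v → AllTerms Decreasing (θ* i v)
θ*-decreasing i v s with isEven i
... | true = []
... | false = AllTerms-scale (ℕtoℚ 2 * powℚ ½ i * recipℕ i) (bNeg i v) (AllTerms-bNeg i v s (bNegB-decreasing i))

PreservesDecreasing : OpSeries → Set
PreservesDecreasing X = ∀ i v → AllTerms Decreasing v → AllTerms Decreasing (X i v)

powS-decreasing : ∀ X → PreservesDecreasing X → ∀ r → PreservesDecreasing (powS r X)
powS-decreasing X h zero zero v s = s
powS-decreasing X h zero (suc k) v s = []
powS-decreasing X h (suc r) k v s =
  AllTerms-concatMap (λ i → X i (powS r X (k ∸ i) v)) (upTo (suc k)) (λ i → h i _ (powS-decreasing X h r (k ∸ i) v s))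

expS-decreasing : ∀ X → PreservesDecreasing X → PreservesDecreasing (expS X)
expS-decreasing X h k v s = AllTerms-concatMap (λ r → scale (recipℕ (r ℕ.!)) (powS r X k v)) (upTo (suc k))
  (λ r → AllTerms-scale (recipℕ (r ℕ.!)) (powS r X k v) (powS-decreasing X h r k v s))

vac-decreasing : AllTerms Decreasing vac
vac-decreasing = tt ∷ []

pair-twoPointᵀ-θ* : ∀ i x y u → AllTerms Decreasing u →
                    pair (twoPointᵀ x y) (θ* i u) ≡ τ i * (- pair (twoPointᵀ (x ℤ.+ + i) y) u + - pair (twoPointᵀ x (y ℤ.+ + i)) u)
pair-twoPointᵀ-θ* zero x y u s = sym (*-zeroˡ (- pair (twoPointᵀ (x ℤ.+ + zero) y) u + - pair (twoPointᵀ x (y ℤ.+ + zero)) u))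
pair-twoPointᵀ-θ* (suc i) x y u s with isEven (suc i) in eq
... | true = sym (*-zeroˡ (- pair (twoPointᵀ (x ℤ.+ + suc i) y) u + - pair (twoPointᵀ x (y ℤ.+ + suc i)) u))
... | false = begin
  pair (twoPointᵀ x y) (scale c (bNeg (suc i) u))
    ≡⟨ pair-scale (twoPointᵀ x y) c (bNeg (suc i) u) ⟩
  c * pair (twoPointᵀ x y) (bNeg (suc i) u)
    ≡⟨ cong (c *_) (trans (pair-bNeg (twoPointᵀ x y) (suc i) u)
          (trans (pair-cong-on u s (λ b sb → bNegᵀ-twoPointᵀ i x y b eq sb))
            (trans (pair-+ (λ b → - twoPointᵀ (x ℤ.+ + suc i) y b) (λ b → - twoPointᵀ x (y ℤ.+ + suc i) b) u)
              (cong₂ _+_ (pair-neg (twoPointᵀ (x ℤ.+ + suc i) y) u) (pair-neg (twoPointᵀ x (y ℤ.+ + suc i)) u))))) ⟩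
  c * (- pair (twoPointᵀ (x ℤ.+ + suc i) y) u + - pair (twoPointᵀ x (y ℤ.+ + suc i)) u) ∎
  where
    open ≡-Reasoning
    c = ℕtoℚ 2 * powℚ ½ (suc i) * recipℕ (suc i)

twoPointPow : ℕ → ℤ → ℤ → ℕ → ℚ
twoPointPow r x y k = pair (twoPointᵀ x y) (powS r θ* k vac)

twoPointPow-suc : ∀ r x y k →
  twoPointPow (suc r) x y k ≡ ∑ (suc k) (λ i → τ i * (- twoPointPow r (x ℤ.+ + i) y (k ∸ i) + - twoPointPow r x (y ℤ.+ + i) (k ∸ i)))
twoPointPow-suc r x y k = trans (pair-concatMap (twoPointᵀ x y) (λ i → θ* i (powS r θ* (k ∸ i) vac)) (upTo (suc k)))
  (trans (∑ₗ-upTo (suc k) (λ i → pair (twoPointᵀ x y) (θ* i (powS r θ* (k ∸ i) vac))))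
    (∑-cong (suc k) (λ i → pair-twoPointᵀ-θ* i x y (powS r θ* (k ∸ i) vac) (powS-decreasing θ* θ*-decreasing r (k ∸ i) vac vac-decreasing))))

twoPointPow-zero : ∀ x y k → twoPointPow 0 x y k ≡ oneSeries k * twoPointᵀ x y []
twoPointPow-zero x y zero = +-identityʳ _
twoPointPow-zero x y (suc k) = sym (*-zeroˡ (twoPointᵀ x y []))

twoPointᵀ-vac-0 : ∀ x → twoPointᵀ x (+ 0) [] ≡ δℤ x (+ 0)
twoPointᵀ-vac-0 (+ zero) = refl
twoPointᵀ-vac-0 (+ suc n) = refl
twoPointᵀ-vac-0 -[1+ n ] = refl

twoPointᵀ-vac-suc : ∀ x n → twoPointᵀ x (+ suc n) [] ≡ δℤ x -[1+ n ] * twoSign (suc n)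
twoPointᵀ-vac-suc (+ zero) n = sym (*-zeroˡ (twoSign (suc n)))
twoPointᵀ-vac-suc (+ suc m) n = trans (creatᵀ-[] (suc n) (creatᵀ (suc m) vacᵀ)) (trans (vacᵀ-creat (suc m) (suc n ∷ [])) (sym (*-zeroˡ (twoSign (suc n)))))
twoPointᵀ-vac-suc -[1+ m ] n with m ℕP.≟ n
... | yes refl = trans (creatᵀ-[] (suc m) (annihᵀ (suc m) vacᵀ))
                      (trans (annihᵀ-self {suc m} vacᵀ [] [])
                             (trans (*-identityʳ (twoSign (suc m)))
                                    (sym (trans (cong (_* twoSign (suc m)) (δℤ-≡ {a = -[1+ m ]} refl)) (*-identityˡ (twoSign (suc m)))))))
... | no ne = trans (creatᵀ-[] (suc n) (annihᵀ (suc m) vacᵀ))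
               (trans (annihᵀ-≢ {suc m} {suc n} vacᵀ [] (λ e → ne (sym (ℕP.suc-injective e))))
                 (sym (trans (cong (_* twoSign (suc n)) (δℤ-≢ (λ e → ne (neg-inj e)))) (*-zeroˡ (twoSign (suc n))))))
  where
    neg-inj : ∀ {a b} → -[1+ a ] ≡ -[1+ b ] → a ≡ b
    neg-inj refl = refl

τ-even : ∀ k → isEven k ≡ true → τ k ≡ 0ℚ
τ-even k e rewrite e = refl

twoPointPow-1 : ∀ x y k → twoPointPow 1 x y k ≡ τ k * (- twoPointᵀ (x ℤ.+ + k) y [] + - twoPointᵀ x (y ℤ.+ + k) [])
twoPointPow-1 x y k = trans (twoPointPow-suc 0 x y k) (trans (∑-single (suc k) k F (ℕP.n<1+n k) F≡0) F-k)
  where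
  G : ℕ → ℕ → ℚ
  G i m = - twoPointPow 0 (x ℤ.+ + i) y m + - twoPointPow 0 x (y ℤ.+ + i) m
  F = λ i → τ i * G i (k ∸ i)
  H : ℕ → ℚ
  H i = - twoPointᵀ (x ℤ.+ + i) y [] + - twoPointᵀ x (y ℤ.+ + i) []
  G≡ : ∀ i m → G i m ≡ oneSeries m * H i
  G≡ i m = trans (cong₂ (λ u v → - u + - v) (twoPointPow-zero (x ℤ.+ + i) y m) (twoPointPow-zero x (y ℤ.+ + i) m))
                 (solve 3 (λ o a b → :- (o :* a) :+ :- (o :* b) := o :* (:- a :+ :- b)) refl
                        (oneSeries m) (twoPointᵀ (x ℤ.+ + i) y []) (twoPointᵀ x (y ℤ.+ + i) []))
  F-k : F k ≡ τ k * H k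
  F-k = cong (τ k *_) (trans (G≡ k (k ∸ k)) (trans (cong (λ m → oneSeries m * H k) (ℕP.n∸n≡0 k)) (*-identityˡ (H k))))
  F≡0 : ∀ i → i < suc k → ¬ (i ≡ k) → F i ≡ 0ℚ
  F≡0 i i<1+k i≢k = trans (cong (τ i *_) (trans (G≡ i (k ∸ i)) (trans (cong (_* H i) (oneSeries-∸ i<1+k i≢k)) (*-zeroˡ (H i)))))
                          (*-zeroʳ (τ i))

twoPointPow-1-even : ∀ x y k → isEven k ≡ true → twoPointPow 1 x y k ≡ 0ℚ
twoPointPow-1-even x y k even = trans (twoPointPow-1 x y k) (trans (cong (_* X) (τ-even k even)) (*-zeroˡ X))
  where X = - twoPointᵀ (x ℤ.+ + k) y [] + - twoPointᵀ x (y ℤ.+ + k) []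

convPow-1 : ∀ k → convPow negτ 1 k ≡ negτ k
convPow-1 k = trans (∑-single (suc k) k (λ i → negτ i * oneSeries (k ∸ i)) (ℕP.n<1+n k)
                           (λ i i<1+k i≢k → trans (cong (negτ i *_) (oneSeries-∸ i<1+k i≢k)) (*-zeroʳ (negτ i))))
                    (trans (cong (λ n → negτ k * oneSeries n) (ℕP.n∸n≡0 k)) (*-identityʳ (negτ k)))

twoPointPow-1-pos : ∀ x n k → twoPointPow 1 x (+ suc n) k ≡ 0ℚ
twoPointPow-1-pos x n k with isEven k in eq
... | true = twoPointPow-1-even x (+ suc n) k eq
... | false = trans (twoPointPow-1 x (+ suc n) k) (trans (cong (τ k *_) inner) (*-zeroʳ (τ k)))
  where
    δ = δℤ x -[1+ (n ℕ.+ k) ]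
    inner : - twoPointᵀ (x ℤ.+ + k) (+ suc n) [] + - twoPointᵀ x (+ suc n ℤ.+ + k) [] ≡ 0ℚ
    inner = begin
      - twoPointᵀ (x ℤ.+ + k) (+ suc n) [] + - twoPointᵀ x (+ suc (n ℕ.+ k)) []
        ≡⟨ cong₂ (λ u v → - u + - v) (twoPointᵀ-vac-suc (x ℤ.+ + k) n) (twoPointᵀ-vac-suc x (n ℕ.+ k)) ⟩
      - (δℤ (x ℤ.+ + k) -[1+ n ] * twoSign (suc n)) + - (δ * twoSign (suc n ℕ.+ k))
        ≡⟨ cong₂ (λ u v → - (u * twoSign (suc n)) + - (δ * v))
             (δℤ-cong-⇔ (λ e → trans (x+y≡z⇒x≡z-y x (+ k) _ e) (sym (-[1+n+k]≡-[1+n]-k n k))) (λ e → x≡z-y⇒x+y≡z x (+ k) _ (trans e (-[1+n+k]≡-[1+n]-k n k))))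
             (twoSign-+-odd n k eq) ⟩
      - (δ * twoSign (suc n)) + - (δ * - twoSign (suc n))
        ≡⟨ solve 2 (λ d c → :- (d :* c) :+ :- (d :* (:- c)) := con 0ℚ) refl δ (twoSign (suc n)) ⟩
      0ℚ ∎ where open ≡-Reasoning

twoPointPow-pos : ∀ r x n k → twoPointPow (suc r) x (+ suc n) k ≡ 0ℚ
twoPointPow-pos zero = twoPointPow-1-pos
twoPointPow-pos (suc r) x n k = trans (twoPointPow-suc (suc r) x (+ suc n) k)
  (∑-zero (suc k) (λ i → trans (cong (λ w → τ i * w) (cong₂ (λ u v → - u + - v) (twoPointPow-pos r (x ℤ.+ + i) n (k ∸ i)) (twoPointPow-pos r x (n ℕ.+ i) (k ∸ i))))
                               (*-zeroʳ (τ i))))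

twoPointPow-1-0 : ∀ x k → twoPointPow 1 x (+ 0) k ≡ δℤ x (ℤ.- (+ k)) * (- convPow negτ 1 k)
twoPointPow-1-0 x zero = trans (twoPointPow-1-even x (+ 0) 0 refl) (sym (*-zeroʳ (δℤ x (+ 0))))
twoPointPow-1-0 x (suc k) with isEven (suc k) in eq
... | true = trans (twoPointPow-1-even x (+ 0) (suc k) eq)
                  (sym (trans (cong (λ w → δℤ x -[1+ k ] * - w) (trans (convPow-1 (suc k)) (cong -_ (τ-even (suc k) eq))))
                              (*-zeroʳ (δℤ x -[1+ k ]))))
... | false = begin
  twoPointPow 1 x (+ 0) (suc k)
    ≡⟨ twoPointPow-1 x (+ 0) (suc k) ⟩
  τ (suc k) * (- twoPointᵀ (x ℤ.+ + suc k) (+ 0) [] + - twoPointᵀ x (+ suc k) [])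
    ≡⟨ cong (λ w → τ (suc k) * w) (cong₂ (λ u v → - u + - v)
          (trans (twoPointᵀ-vac-0 (x ℤ.+ + suc k)) (δℤ-cong-⇔ (x+y≡z⇒x≡z-y x (+ suc k) (+ 0)) (x≡z-y⇒x+y≡z x (+ suc k) (+ 0))))
          (trans (twoPointᵀ-vac-suc x k) (cong (δ *_) (cong (ℕtoℚ 2 *_) (sgnℕ-odd (suc k) eq))))) ⟩
  τ (suc k) * (- δ + - (δ * (ℕtoℚ 2 * - 1ℚ)))
    ≡⟨ solve 2 (λ t d → t :* (:- d :+ :- (d :* (con (ℕtoℚ 2) :* (:- con 1ℚ)))) := d :* (:- (:- t))) refl (τ (suc k)) δ ⟩
  δ * (- - τ (suc k))
    ≡⟨ cong (λ w → δ * - w) (sym (convPow-1 (suc k))) ⟩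
  δ * (- convPow negτ 1 (suc k)) ∎
  where
    open ≡-Reasoning
    δ = δℤ x -[1+ k ]

twoPointPow-0 : ∀ r x k → twoPointPow (suc r) x (+ 0) k ≡ δℤ x (ℤ.- (+ k)) * (- convPow negτ (suc r) k)
twoPointPow-0 zero = twoPointPow-1-0
twoPointPow-0 (suc r) x k = begin
  twoPointPow (suc (suc r)) x (+ 0) k
    ≡⟨ twoPointPow-suc (suc r) x (+ 0) k ⟩
  ∑ (suc k) (λ i → τ i * (- twoPointPow (suc r) (x ℤ.+ + i) (+ 0) (k ∸ i) + - twoPointPow (suc r) x (+ i) (k ∸ i)))
    ≡⟨ ∑-cong-< (suc k) (λ i p → term i (ℕP.≤-pred p)) ⟩
  ∑ (suc k) (λ i → δ * (τ i * convPow negτ (suc r) (k ∸ i)))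
    ≡⟨ ∑-* (suc k) δ (λ i → τ i * convPow negτ (suc r) (k ∸ i)) ⟩
  δ * ∑ (suc k) (λ i → τ i * convPow negτ (suc r) (k ∸ i))
    ≡⟨ cong (δ *_) (trans (∑-cong (suc k) (λ i → solve 2 (λ t P → t :* P := :- ((:- t) :* P)) refl (τ i) (convPow negτ (suc r) (k ∸ i))))
                          (∑-neg (suc k) (λ i → negτ i * convPow negτ (suc r) (k ∸ i)))) ⟩
  δ * (- convPow negτ (suc (suc r)) k) ∎
  where
    open ≡-Reasoning
    δ = δℤ x (ℤ.- (+ k))
    term : ∀ i → i ≤ k →
           τ i * (- twoPointPow (suc r) (x ℤ.+ + i) (+ 0) (k ∸ i) + - twoPointPow (suc r) x (+ i) (k ∸ i))
           ≡ δ * (τ i * convPow negτ (suc r) (k ∸ i))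
    term zero p = trans (*-zeroˡ (- twoPointPow (suc r) (x ℤ.+ + 0) (+ 0) (k ∸ 0) + - twoPointPow (suc r) x (+ 0) (k ∸ 0)))
                        (sym (trans (cong (δ *_) (*-zeroˡ (convPow negτ (suc r) (k ∸ 0)))) (*-zeroʳ δ)))
    term (suc i) p = begin
      τ (suc i) * (- twoPointPow (suc r) (x ℤ.+ + suc i) (+ 0) (k ∸ suc i) + - twoPointPow (suc r) x (+ suc i) (k ∸ suc i))
        ≡⟨ cong (λ w → τ (suc i) * w) (cong₂ (λ u v → - u + - v)
              (trans (twoPointPow-0 r (x ℤ.+ + suc i) (k ∸ suc i)) (cong (_* (- P)) (δℤ-cong-⇔ f g)))
              (twoPointPow-pos r x i (k ∸ suc i))) ⟩
      τ (suc i) * (- (δ * - P) + - 0ℚ)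
        ≡⟨ solve 3 (λ t d P → t :* (:- (d :* (:- P)) :+ :- con 0ℚ) := d :* (t :* P)) refl (τ (suc i)) δ P ⟩
      δ * (τ (suc i) * P) ∎
      where
        P = convPow negτ (suc r) (k ∸ suc i)
        ns : ℤ.- (+ (k ∸ suc i)) ≡ ℤ.- (+ k) ℤ.+ + suc i
        ns = k≡i+d⇒-d≡-k+i k (suc i) (k ∸ suc i) (sym (ℕP.m+[n∸m]≡n p))
        f : x ℤ.+ + suc i ≡ ℤ.- (+ (k ∸ suc i)) → x ≡ ℤ.- (+ k)
        f e = ℤ+-cancelʳ (+ suc i) x (ℤ.- (+ k)) (trans e ns)
        g : x ≡ ℤ.- (+ k) → x ℤ.+ + suc i ≡ ℤ.- (+ (k ∸ suc i))
        g e = trans (cong (ℤ._+ + suc i) e) (sym ns)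

twoPointᵀ-expθ* : ∀ j c → pair (twoPointᵀ -[1+ j ] (+ 0)) (expS θ* c vac) ≡ - (δℤ -[1+ j ] (ℤ.- (+ c)) * convExp negτ c)
twoPointᵀ-expθ* j c = begin
  pair (twoPointᵀ x (+ 0)) (expS θ* c vac)
    ≡⟨ pair-concatMap (twoPointᵀ x (+ 0)) (λ r → scale (recipℕ (r ℕ.!)) (powS r θ* c vac)) (upTo (suc c)) ⟩
  ∑ₗ (upTo (suc c)) (λ r → pair (twoPointᵀ x (+ 0)) (scale (recipℕ (r ℕ.!)) (powS r θ* c vac)))
    ≡⟨ ∑ₗ-upTo (suc c) (λ r → pair (twoPointᵀ x (+ 0)) (scale (recipℕ (r ℕ.!)) (powS r θ* c vac))) ⟩
  ∑ (suc c) (λ r → pair (twoPointᵀ x (+ 0)) (scale (recipℕ (r ℕ.!)) (powS r θ* c vac)))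
    ≡⟨ ∑-cong (suc c) (λ r → trans (pair-scale (twoPointᵀ x (+ 0)) (recipℕ (r ℕ.!)) (powS r θ* c vac)) (term r)) ⟩
  ∑ (suc c) (λ r → δ * - (recipℕ (r ℕ.!) * convPow negτ r c))
    ≡⟨ trans (∑-* (suc c) δ (λ r → - (recipℕ (r ℕ.!) * convPow negτ r c))) (cong (δ *_) (∑-neg (suc c) (λ r → recipℕ (r ℕ.!) * convPow negτ r c))) ⟩
  δ * - convExp negτ c
    ≡⟨ solve 2 (λ d E → d :* (:- E) := :- (d :* E)) refl δ (convExp negτ c) ⟩
  - (δ * convExp negτ c) ∎
  where
    open ≡-Reasoning
    x = -[1+ j ]
    δ = δℤ x (ℤ.- (+ c))
    term : ∀ r → recipℕ (r ℕ.!) * twoPointPow r x (+ 0) c ≡ δ * - (recipℕ (r ℕ.!) * convPow negτ r c)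
    term zero = trans (cong (recipℕ 1 *_) (trans (twoPointPow-zero x (+ 0) c) (*-zeroʳ (oneSeries c)))) (trans (*-zeroʳ (recipℕ 1)) (sym (r0 c)))
      where
        r0 : ∀ c → δℤ x (ℤ.- (+ c)) * - (recipℕ 1 * oneSeries c) ≡ 0ℚ
        r0 zero = *-zeroˡ (- (recipℕ 1 * oneSeries 0))
        r0 (suc c) = *-zeroʳ (δℤ x (ℤ.- (+ suc c)))
    term (suc r) = trans (cong (recipℕ (suc r ℕ.!) *_) (twoPointPow-0 r x c))
                   (solve 3 (λ R d P → R :* (d :* (:- P)) := d :* (:- (R :* P))) refl (recipℕ (suc r ℕ.!)) δ (convPow negτ (suc r) c))

Concentrated : ℕ → (Basis → ℚ) → Set
Concentrated e g = ∀ z → ¬ (z ≡ e ∷ []) → g z ≡ 0ℚ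

annihᵀ-vac-concentrated : ∀ k → Concentrated k (annihᵀ k vacᵀ)
annihᵀ-vac-concentrated k [] _ = refl
annihᵀ-vac-concentrated k (n ∷ ns) z≢k with n ℕP.≟ k
... | yes refl rewrite ≡ᵇ-refl n =
  trans (cong (λ w → twoSign n * vacᵀ ns + w) (trans (pair-negPrefix vacᵀ n (annih n ns)) (cong -_ (pair-0 (annih n ns)))))
        (head-only ns z≢k)
  where
  head-only : ∀ ns → ¬ (n ∷ ns ≡ n ∷ []) → twoSign n * vacᵀ ns + - 0ℚ ≡ 0ℚ
  head-only [] ne = ⊥-elim (ne refl)
  head-only (_ ∷ _) _ = trans (+-identityʳ (twoSign n * 0ℚ)) (*-zeroʳ (twoSign n))
... | no n≢k rewrite ≢⇒≡ᵇ≡false n≢k = trans (pair-negPrefix vacᵀ n (annih k ns)) (cong -_ (pair-0 (annih k ns)))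

act0ᵀ-vac-concentrated : Concentrated 0 (act0ᵀ vacᵀ)
act0ᵀ-vac-concentrated [] _ = refl
act0ᵀ-vac-concentrated (zero ∷ []) z≢0 = ⊥-elim (z≢0 refl)
act0ᵀ-vac-concentrated (zero ∷ _ ∷ _) _ = refl
act0ᵀ-vac-concentrated (suc n ∷ ns) _ = trans (pair-negPrefix vacᵀ (suc n) (act0 ns)) (cong -_ (pair-0 (act0 ns)))

creatᵀ-concentrated-∷ : ∀ {e g} k n ns → Concentrated e g → creatᵀ k g (n ∷ ns) ≡ 0ℚ
creatᵀ-concentrated-∷ {g = g} k n ns conc =
  trans (pair-cong-on (creat k (n ∷ ns)) (creat-length k (n ∷ ns)) too-long) (pair-0 (creat k (n ∷ ns)))
  where
  too-long : ∀ z → length z ≡ suc (suc (length ns)) → g z ≡ 0ℚ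
  too-long z lz = conc z (λ p → ℕP.0≢1+n (ℕP.suc-injective (trans (sym (cong length p)) lz)))

creatᵀ-concentrated-≢ : ∀ {e g} k x → Concentrated e g → ¬ (k ≡ e) → creatᵀ k g x ≡ 0ℚ
creatᵀ-concentrated-≢ {g = g} k [] conc k≢e = trans (pair-basis g (k ∷ [])) (conc (k ∷ []) (λ p → k≢e (∷-injectiveˡ p)))
creatᵀ-concentrated-≢ k (n ∷ ns) conc _ = creatᵀ-concentrated-∷ k n ns conc

twoPointᵀ-self : ∀ j z → twoPointᵀ -[1+ j ] (+ suc j) z ≡ twoSign (suc j) * vacᵀ z
twoPointᵀ-self j [] = trans (creatᵀ-[] (suc j) (annihᵀ (suc j) vacᵀ)) (annihᵀ-self {suc j} vacᵀ [] [])
twoPointᵀ-self j (n ∷ ns) =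
  trans (creatᵀ-concentrated-∷ (suc j) n ns (annihᵀ-vac-concentrated (suc j))) (sym (*-zeroʳ (twoSign (suc j))))

twoPointᵀ-≢ : ∀ j b z → ¬ (b ≡ j) → twoPointᵀ -[1+ j ] (+ suc b) z ≡ 0ℚ
twoPointᵀ-≢ j b z b≢j = creatᵀ-concentrated-≢ (suc b) z (annihᵀ-vac-concentrated (suc j)) (λ e → b≢j (ℕP.suc-injective e))

vacᵀ-θ* : ∀ i w → pair vacᵀ (θ* i w) ≡ 0ℚ
vacᵀ-θ* zero w = refl
vacᵀ-θ* (suc i) w with isEven (suc i)
... | true = refl
... | false = trans (pair-scale vacᵀ c (bNeg (suc i) w))
                    (trans (cong (c *_) (trans (pair-bNeg vacᵀ (suc i) w) (trans (pair-cong w (bNegᵀ-vac i)) (pair-0 w))))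
                           (*-zeroʳ c))
  where c = ℕtoℚ 2 * powℚ ½ (suc i) * recipℕ (suc i)

vacᵀ-negθ* : ∀ i w → pair vacᵀ (negS θ* i w) ≡ 0ℚ
vacᵀ-negθ* i w = trans (pair-scale vacᵀ (- 1ℚ) (θ* i w)) (trans (cong (- 1ℚ *_) (vacᵀ-θ* i w)) (*-zeroʳ (- 1ℚ)))

vacᵀ-powS : ∀ X → (∀ i w → pair vacᵀ (X i w) ≡ 0ℚ) → ∀ r k w → pair vacᵀ (powS (suc r) X k w) ≡ 0ℚ
vacᵀ-powS X vacᵀ-X r k w = trans (pair-concatMap vacᵀ (λ i → X i (powS r X (k ∸ i) w)) (upTo (suc k)))
                                 (∑ₗ-zero (upTo (suc k)) _ (λ i → vacᵀ-X i (powS r X (k ∸ i) w)))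

vacᵀ-expS-suc : ∀ X → (∀ i w → pair vacᵀ (X i w) ≡ 0ℚ) → ∀ k w → pair vacᵀ (expS X (suc k) w) ≡ 0ℚ
vacᵀ-expS-suc X vacᵀ-X k w =
  trans (pair-concatMap vacᵀ (λ r → scale (recipℕ (r ℕ.!)) (powS r X (suc k) w)) (upTo (suc (suc k))))
        (∑ₗ-zero (upTo (suc (suc k))) _ term)
  where
  term : ∀ r → pair vacᵀ (scale (recipℕ (r ℕ.!)) (powS r X (suc k) w)) ≡ 0ℚ
  term zero = refl
  term (suc r) = trans (pair-scale vacᵀ (recipℕ (suc r ℕ.!)) (powS (suc r) X (suc k) w))
                       (trans (cong (recipℕ (suc r ℕ.!) *_) (vacᵀ-powS X vacᵀ-X r (suc k) w)) (*-zeroʳ (recipℕ (suc r ℕ.!))))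

vev-expθ* : ∀ n → pair vacᵀ (expS θ* n vac) ≡ oneSeries n
vev-expθ* zero = refl
vev-expθ* (suc n) = vacᵀ-expS-suc θ* vacᵀ-θ* n vac

vev-expNegθ*-⊛ : ∀ (R : OpSeries) k → pair vacᵀ ((expS (negS θ*) ⊛ R) k vac) ≡ pair vacᵀ (R k vac)
vev-expNegθ*-⊛ R k = begin
  pair vacᵀ ((expS (negS θ*) ⊛ R) k vac)
    ≡⟨ pair-concatMap vacᵀ (λ i → expS (negS θ*) i (R (k ∸ i) vac)) (upTo (suc k)) ⟩
  ∑ₗ (upTo (suc k)) (λ i → pair vacᵀ (expS (negS θ*) i (R (k ∸ i) vac)))
    ≡⟨ ∑ₗ-upTo (suc k) (λ i → pair vacᵀ (expS (negS θ*) i (R (k ∸ i) vac))) ⟩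
  pair vacᵀ (expS (negS θ*) 0 (R k vac)) + ∑ k (λ i → pair vacᵀ (expS (negS θ*) (suc i) (R (k ∸ suc i) vac)))
    ≡⟨ cong₂ _+_ order-0 (∑-zero k (λ i → vacᵀ-expS-suc (negS θ*) vacᵀ-negθ* i (R (k ∸ suc i) vac))) ⟩
  pair vacᵀ (R k vac) + 0ℚ
    ≡⟨ +-identityʳ _ ⟩
  pair vacᵀ (R k vac) ∎
  where
  open ≡-Reasoning
  order-0 : pair vacᵀ (expS (negS θ*) 0 (R k vac)) ≡ pair vacᵀ (R k vac)
  order-0 = trans (pair-++ vacᵀ (scale (recipℕ 1) (R k vac)) [])
                  (trans (+-identityʳ _) (trans (pair-scale vacᵀ (recipℕ 1) (R k vac)) (*-identityˡ _)))

φRound₀-coeff : ℕ → ℚ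
φRound₀-coeff b = ℕtoℚ ((0 ℕ.+ b) C 0) * powℚ ½ b

φRound₀expθ* : OpSeries
φRound₀expθ* = toOp (φRound 0) ⊛ expS θ*

pair-φRound₀ : ∀ g b u → pair g (toOp (φRound 0) b u) ≡ φRound₀-coeff b * pair (φᵀ (+ b) g) u
pair-φRound₀ g b u =
  trans (pair-++ g (scale (φRound₀-coeff b) (φ (+ b) u)) [])
        (trans (+-identityʳ (pair g (scale (φRound₀-coeff b) (φ (+ b) u))))
               (trans (pair-scale g (φRound₀-coeff b) (φ (+ b) u)) (cong (φRound₀-coeff b *_) (pair-φ g (+ b) u))))

pair-φRound₀expθ* : ∀ g c →
  pair g (φRound₀expθ* c vac) ≡ ∑ (suc c) (λ b → φRound₀-coeff b * pair (φᵀ (+ b) g) (expS θ* (c ∸ b) vac))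
pair-φRound₀expθ* g c =
  trans (pair-concatMap g (λ b → toOp (φRound 0) b (expS θ* (c ∸ b) vac)) (upTo (suc c)))
        (trans (∑ₗ-upTo (suc c) (λ b → pair g (toOp (φRound 0) b (expS θ* (c ∸ b) vac))))
               (∑-cong (suc c) (λ b → pair-φRound₀ g b (expS θ* (c ∸ b) vac))))

expθ*-vac-decreasing : ∀ n → AllTerms Decreasing (expS θ* n vac)
expθ*-vac-decreasing n = expS-decreasing θ* θ*-decreasing n vac vac-decreasing

annihᵀ-vac-φRound₀expθ* : ∀ j c → pair (annihᵀ (suc j) vacᵀ) (φRound₀expθ* c vac) ≡ 0ℚ
annihᵀ-vac-φRound₀expθ* j c = trans (pair-φRound₀expθ* (annihᵀ (suc j) vacᵀ) c) (terms c)
  where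
  n = suc j
  c₀ = φRound₀-coeff
  corr : ℕ → ℕ → ℚ
  corr c b = pair (twoPointᵀ -[1+ j ] (+ b)) (expS θ* (c ∸ b) vac)
  corr-self : ∀ c → corr c n ≡ twoSign n * oneSeries (c ∸ n)
  corr-self c = trans (pair-cong (expS θ* (c ∸ n) vac) (twoPointᵀ-self j))
                   (trans (pair-* (twoSign n) vacᵀ (expS θ* (c ∸ n) vac)) (cong (twoSign n *_) (vev-expθ* (c ∸ n))))
  corr-≢ : ∀ c b → ¬ (b ≡ j) → corr c (suc b) ≡ 0ℚ
  corr-≢ c b b≢j = trans (pair-cong (expS θ* (c ∸ suc b) vac) (λ z → twoPointᵀ-≢ j b z b≢j)) (pair-0 (expS θ* (c ∸ suc b) vac))
  terms : ∀ c → ∑ (suc c) (λ b → c₀ b * corr c b) ≡ 0ℚ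
  terms c with c ℕP.≟ n
  ... | yes refl = begin
    c₀ 0 * corr n 0 + ∑ n (λ b → c₀ (suc b) * corr n (suc b))
      ≡⟨ cong₂ _+_ (cong (c₀ 0 *_) (trans (twoPointᵀ-expθ* j n) (cong₂ (λ u v → - (u * v)) (δℤ-≡ {a = -[1+ j ]} refl) (convExp-negτ n))))
                   (∑-single n j (λ b → c₀ (suc b) * corr n (suc b)) (ℕP.n<1+n j)
                      (λ b _ b≢j → trans (cong (c₀ (suc b) *_) (corr-≢ n b b≢j)) (*-zeroʳ (c₀ (suc b))))) ⟩
    c₀ 0 * - (1ℚ * ρ n) + c₀ n * corr n n
      ≡⟨ cong (λ w → c₀ 0 * - (1ℚ * ρ n) + c₀ n * w) (trans (corr-self n) (cong (λ m → twoSign n * oneSeries m) (ℕP.n∸n≡0 j))) ⟩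
    1ℚ * - (1ℚ * (powℚ ½ n * twoSign n)) + (1ℚ * powℚ ½ n) * (twoSign n * 1ℚ)
      ≡⟨ solve 2 (λ p c → con 1ℚ :* (:- (con 1ℚ :* (p :* c))) :+ (con 1ℚ :* p) :* (c :* con 1ℚ) := con 0ℚ) refl (powℚ ½ n) (twoSign n) ⟩
    0ℚ ∎ where open ≡-Reasoning
  ... | no c≢n = ∑-zero-< (suc c) term
    where
    term : ∀ b → b < suc c → c₀ b * corr c b ≡ 0ℚ
    term zero _ = trans (cong (c₀ 0 *_) (trans (twoPointᵀ-expθ* j c) (cong -_ (trans (cong (_* convExp negτ c) (δℤ-≢ x≢-c)) (*-zeroˡ (convExp negτ c))))))
                        (*-zeroʳ (c₀ 0))
      where
      x≢-c : ¬ (-[1+ j ] ≡ ℤ.- (+ c))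
      x≢-c e = c≢n (sym (ℤP.+-injective (trans (cong ℤ.-_ e) (ℤP.neg-involutive (+ c)))))
    term (suc b) b<1+c with b ℕP.≟ j
    ... | no b≢j = trans (cong (c₀ (suc b) *_) (corr-≢ c b b≢j)) (*-zeroʳ (c₀ (suc b)))
    ... | yes refl with ℕP.m≤n⇒∃[o]m+o≡n (ℕP.≤∧≢⇒< (ℕP.≤-pred b<1+c) (λ e → c≢n (sym e)))
    ...   | d , refl = trans (cong (c₀ n *_) (trans (corr-self (suc n ℕ.+ d)) (cong (λ m → twoSign n * oneSeries m) (suc-+-∸ n d))))
                             (trans (cong (c₀ n *_) (*-zeroʳ (twoSign n))) (*-zeroʳ (c₀ n)))

act0ᵀ-vac-φRound₀expθ*-suc : ∀ c → pair (act0ᵀ vacᵀ) (φRound₀expθ* (suc c) vac) ≡ 0ℚ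
act0ᵀ-vac-φRound₀expθ*-suc c = trans (pair-φRound₀expθ* (act0ᵀ vacᵀ) (suc c)) (∑-zero (suc (suc c)) term)
  where
  term : ∀ b → φRound₀-coeff b * pair (φᵀ (+ b) (act0ᵀ vacᵀ)) (expS θ* (suc c ∸ b) vac) ≡ 0ℚ
  term zero = trans (cong (φRound₀-coeff 0 *_)
                          (trans (pair-cong-on (expS θ* (suc c) vac) (expθ*-vac-decreasing (suc c)) (act0ᵀ-involutive vacᵀ))
                                 (vev-expθ* (suc c))))
                    (*-zeroʳ (φRound₀-coeff 0))
  term (suc b) = trans (cong (φRound₀-coeff (suc b) *_)
                             (trans (pair-cong (expS θ* (suc c ∸ suc b) vac) (λ x → creatᵀ-concentrated-≢ (suc b) x act0ᵀ-vac-concentrated (λ ())))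
                                    (pair-0 (expS θ* (suc c ∸ suc b) vac))))
                       (*-zeroʳ (φRound₀-coeff (suc b)))

vacᵀ-φᵀ-pos : ∀ k u → pair (φᵀ (+ suc k) vacᵀ) u ≡ 0ℚ
vacᵀ-φᵀ-pos k u = trans (pair-cong u (vacᵀ-creat (suc k))) (pair-0 u)

pair-toOp-vanish : ∀ g (F : FSeries) a u → All (λ p → pair (φᵀ (proj₂ p) g) u ≡ 0ℚ) (F a) → pair g (toOp F a u) ≡ 0ℚ
pair-toOp-vanish g F a u vanish =
  trans (pair-concatMap g (λ p → scale (proj₁ p) (φ (proj₂ p) u)) (F a))
        (∑ₗ-zero-All (F a) (λ p → pair g (scale (proj₁ p) (φ (proj₂ p) u)))
          (All.map (λ {p} e → trans (pair-scale g (proj₁ p) (φ (proj₂ p) u))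
                                    (trans (cong (proj₁ p *_) (trans (pair-φ g (proj₂ p) u) e)) (*-zeroʳ (proj₁ p))))
                   vanish))

φBracketStar-pos-vanish : ∀ q a c → All (λ p → pair (φᵀ (proj₂ p) vacᵀ) (φRound₀expθ* c vac) ≡ 0ℚ) (φBracketStar (+ suc q) a)
φBracketStar-pos-vanish q a c with a ℕ.≤ᵇ q in eq
... | false = []
... | true = subst (λ n → pair (φᵀ (ℤ.- (+ n)) vacᵀ) (φRound₀expθ* c vac) ≡ 0ℚ)
                  (sym (ℕP.+-∸-assoc 1 (ℕP.≤ᵇ⇒≤ a q (subst T (sym eq) tt))))
                  (annihᵀ-vac-φRound₀expθ* (q ∸ a) c)
            ∷ []

vevCoeff-expand : ∀ m k → vevCoeff m k ≡ ∑ (suc k) (λ a → pair vacᵀ (toOp (φBracketStar m) a (φRound₀expθ* (k ∸ a) vac)))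
vevCoeff-expand m k =
  trans (vev≡pair-vacᵀ ((expS (negS θ*) ⊛ (toOp (φBracketStar m) ⊛ φRound₀expθ*)) k vac))
        (trans (vev-expNegθ*-⊛ (toOp (φBracketStar m) ⊛ φRound₀expθ*) k)
               (trans (pair-concatMap vacᵀ (λ a → toOp (φBracketStar m) a (φRound₀expθ* (k ∸ a) vac)) (upTo (suc k)))
                      (∑ₗ-upTo (suc k) (λ a → pair vacᵀ (toOp (φBracketStar m) a (φRound₀expθ* (k ∸ a) vac))))))

lemma3p19 : (m : ℤ) (k : ℕ) → vevCoeff m k ≡ δCoeff m k
lemma3p19 (+ zero) zero = refl
lemma3p19 (+ zero) (suc k) = trans (vevCoeff-expand (+ zero) (suc k)) (∑-zero (suc (suc k)) term)
  where
  term : ∀ a → pair vacᵀ (toOp (φBracketStar (+ zero)) a (φRound₀expθ* (suc k ∸ a) vac)) ≡ 0ℚ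
  term zero = pair-toOp-vanish vacᵀ (φBracketStar (+ zero)) 0 (φRound₀expθ* (suc k) vac)
                (act0ᵀ-vac-φRound₀expθ*-suc k ∷ [])
  term (suc a) = pair-toOp-vanish vacᵀ (φBracketStar (+ zero)) (suc a) (φRound₀expθ* (k ∸ a) vac)
                   (vacᵀ-φᵀ-pos a (φRound₀expθ* (k ∸ a) vac) ∷ [])
lemma3p19 (+ suc q) k = trans (vevCoeff-expand (+ suc q) k)
  (∑-zero (suc k) (λ a → pair-toOp-vanish vacᵀ (φBracketStar (+ suc q)) a (φRound₀expθ* (k ∸ a) vac)
                           (φBracketStar-pos-vanish q a (k ∸ a))))
lemma3p19 -[1+ p ] k = trans (vevCoeff-expand -[1+ p ] k)
  (∑-zero (suc k) (λ a → pair-toOp-vanish vacᵀ (φBracketStar -[1+ p ]) a (φRound₀expθ* (k ∸ a) vac)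
                           (vacᵀ-φᵀ-pos (p ℕ.+ a) (φRound₀expθ* (k ∸ a) vac) ∷ [])))
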